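{- Let $k\ge1$ and let $G$ be the ladder graph with $k$ squares, i.e. the grid graph $P_2\,\square\,P_{k+1}$ (Cartesian product of a path on $2$ vertices and a path on $k+1$ vertices). Then \[ \mathrm{pn}(G)=36\cdot2^{k}-\frac13k^3-4k^2-\frac{56}{3}k-33 . \]
   Context: For a graph $G$, the subpath number $\mathrm{pn}(G)$ is the number of paths (as subgraphs, i.e. unordered) in $G$, including the trivial paths of length $0$ (single vertices). -}

module Defs where

open import Data.Nat using (ℕ; zero; suc; _*_)
open import Data.Fin using (Fin; toℕ; inject₁; remQuot)
import Data.Fin as F
open import Data.Bool using (Bool; true)
open import Data.Vec using (Vec; lookup)
open import Data.Product using (Σ; ∃; ∃-syntax; _×_; _,_)
open import Data.Sum using (_⊎_)
open import Data.List using (List; length)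
open import Data.List.Membership.Propositional using (_∈_)
open import Data.List.Relation.Unary.Unique.Propositional using (Unique)
open import Function.Bundles using (_⇔_)
open import Function.Definitions using (Injective)
open import Relation.Binary.PropositionalEquality using (_≡_)

record Graph (n : ℕ) : Set₁ where
  field
    Adj : Fin n → Fin n → Set
open Graph public

PathGraph : (n : ℕ) → Graph n
Adj (PathGraph n) i j = (suc (toℕ i) ≡ toℕ j) ⊎ (suc (toℕ j) ≡ toℕ i)

_□_ : {m n : ℕ} → Graph m → Graph n → Graph (m * n)
Adj (_□_ {m} {n} G H) u v with remQuot n u | remQuot n v
... | (x , y) | (x' , y') = (Adj G x x' × y ≡ y') ⊎ (x ≡ x' × Adj H y y')

Ladder : (k : ℕ) → Graph (2 * suc k)
Ladder k = PathGraph 2 □ PathGraph (suc k)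

-- A subgraph datum: a vertex subset and an edge subset (adjacency matrix) of Fin n.
Subgraph : ℕ → Set
Subgraph n = Vec Bool n × Vec (Vec Bool n) n

InV : {n : ℕ} → Subgraph n → Fin n → Set
InV (S , _) v = lookup S v ≡ true

InE : {n : ℕ} → Subgraph n → Fin n → Fin n → Set
InE (_ , E) u v = lookup (lookup E u) v ≡ true

-- H is a path in G: there is a sequence f 0, ..., f m of distinct vertices with consecutive
-- ones adjacent in G, such that H has exactly the vertices f i and exactly the edges
-- {f i, f (i+1)} (edge matrix recorded symmetrically). m = 0 gives the trivial paths.
IsPathIn : {n : ℕ} → Graph n → Subgraph n → Set
IsPathIn {n} G H =
  Σ ℕ λ m → Σ (Fin (suc m) → Fin n) λ f →
    Injective _≡_ _≡_ f
    × (∀ (i : Fin m) → Adj G (f (inject₁ i)) (f (F.suc i)))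
    × (∀ v → InV H v ⇔ (∃[ i ] f i ≡ v))
    × (∀ u v → InE H u v ⇔
         (∃[ i ] ((f (inject₁ i) ≡ u × f (F.suc i) ≡ v) ⊎ (f (inject₁ i) ≡ v × f (F.suc i) ≡ u))))

HasCount : {n : ℕ} → (Subgraph n → Set) → ℕ → Set
HasCount {n} P c =
  Σ (List (Subgraph n)) λ L → Unique L × length L ≡ c × (∀ H → H ∈ L ⇔ P H)

SubpathNumber : {n : ℕ} → Graph n → ℕ → Set
SubpathNumber G c = HasCount (IsPathIn G) c

-- A path subgraph with at least two vertices is traced by exactly two vertex sequences without
-- repetition (one for each direction), a one-vertex path by one, so 2 · pn(G) = W + |V(G)| − 1, where
-- W counts these sequences, the empty one included.
-- For ladders W is computed by adding one rung at a time. A path either avoids the new rung, or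
-- passes through exactly one new corner x, where it splits into two disjoint legs hanging from x
-- into the old ladder, or passes through both new corners: split at one of them, the other corner
-- comes either right next or at the end of a crossing of the old ladder from corner to corner.
-- This gives linear recurrences for the numbers of paths starting at a corner (3·2ⁿ − n − 3 for n
-- rungs), of crossings (n), of pairs of disjoint legs from the two corners (12·2ⁿ − n² − 6n − 11),
-- and finally 3W = 108·2ⁿ − 2n³ − 18n² − 76n − 105; the ladder with k squares has n = k + 1 rungs.

module Submission where

open import Level using (0ℓ)
open import Data.Nat using (ℕ; zero; suc; _+_; _*_; _^_; _≤_)
open import Data.Nat.Properties using (suc-injective; *-cancelˡ-≡)
open import Data.Nat.Tactic.RingSolver using (solve-∀)
open import Data.Bool using (Bool; true; false; not)
import Data.Bool as Bool
open import Data.Bool.Properties using (⇔→≡; not-¬)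
open import Data.Fin using (Fin; zero; suc; inject₁; combine; remQuot)
import Data.Fin as Fin
open import Data.Fin.Properties using (remQuot-combine; combine-remQuot)
import Data.Fin.Properties as Finₚ
open import Data.Vec using (Vec; lookup; tabulate)
open import Data.Vec.Properties using (lookup∘tabulate; tabulate∘lookup; tabulate-cong)
open import Data.Maybe using (just)
open import Data.Maybe.Properties using (just-injective)
open import Data.Maybe.Relation.Binary.Pointwise using (Pointwise; just)
import Data.Maybe.Relation.Binary.Pointwise as Pointwise
open import Data.Product using (Σ-syntax; ∃-syntax; ∃₂; _×_; _,_; proj₁; proj₂; swap; map₁)
open import Data.Product.Properties using (≡-dec)
open import Data.Sum using (_⊎_; inj₁; inj₂; [_,_]′)
import Data.Sum as Sum
open import Data.Empty using (⊥-elim)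
open import Data.Unit using (⊤; tt)
open import Data.List
  using (List; []; _∷_; _++_; _∷ʳ_; [_]; length; map; filter; head; reverse; _ʳ++_; allFin)

import Data.List as List
open import Data.List.Properties
  using ( ∷-injective; ∷-injectiveʳ; ∷ʳ-injectiveˡ; ++-assoc; length-++; length-map; length-tabulate
        ; map-injective; map-∘; map-cong; map-id; tabulate-lookup
        ; ʳ++-defn; unfold-reverse; reverse-++; reverse-map; reverse-involutive; reverse-injective )
open import Data.List.Reverse using (reverseView; []; _∶_∶ʳ_)
open import Data.List.Membership.Propositional using (_∈_; _∉_)
open import Data.List.Membership.Propositional.Properties
  using ( ∈-map⁺; ∈-map⁻; ∈-++⁺ˡ; ∈-++⁺ʳ; ∈-++⁻; ∈-∃++; ∈-filter⁺; ∈-filter⁻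
        ; ∈-tabulate⁺; ∈-tabulate⁻; ∈-allFin )
open import Data.List.Membership.Propositional.Properties.WithK using (unique∧set⇒bag)
import Data.List.Membership.DecPropositional as DecMembership
open import Data.List.Relation.Unary.Any using (here; there)
import Data.List.Relation.Unary.Any.Properties as Any
open import Data.List.Relation.Unary.All using (All; []; _∷_)
import Data.List.Relation.Unary.All as All
open import Data.List.Relation.Unary.All.Properties using (¬Any⇒All¬; All¬⇒¬Any)
open import Data.List.Relation.Unary.AllPairs using ([]; _∷_)
open import Data.List.Relation.Unary.Linked using (Linked; []; [-]; _∷_)
import Data.List.Relation.Unary.Linked as Linked
import Data.List.Relation.Unary.Linked.Properties as Linkedₚ
open import Data.List.Relation.Unary.Unique.Propositional using (Unique)
import Data.List.Relation.Unary.Unique.Propositional.Properties as Unique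
open import Data.List.Relation.Binary.Disjoint.Propositional using (Disjoint; contractₗ; contractᵣ)
import Data.List.Relation.Binary.Disjoint.Propositional.Properties as Disjoint
open import Data.List.Relation.Binary.BagAndSetEquality using (∼bag⇒↭)
open import Data.List.Relation.Binary.Permutation.Propositional using (↭-sym; ↭⇒↭ₛ)
open import Data.List.Relation.Binary.Permutation.Propositional.Properties using (↭-length; ↭-reverse)
import Data.List.Relation.Binary.Permutation.Setoid.Properties as Permutationₛ
open import Function using (_∘_; id)
open import Function.Bundles using (_⇔_; mk⇔; Equivalence)
open import Function.Definitions using (Injective)
open import Function.Properties.Equivalence using () renaming (trans to ⇔-trans; sym to ⇔-sym)
open import Relation.Nullary using (¬_; Dec; yes; no; does)
open import Relation.Nullary.Decidable using (_⊎-dec_)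
open import Relation.Binary.Definitions using (DecidableEquality; Symmetric)
open import Relation.Binary.PropositionalEquality
  using (_≡_; _≢_; refl; sym; trans; cong; cong₂; subst; subst₂; setoid; module ≡-Reasoning)
open import Relation.Unary using (Pred; _∩_; _∪_; ∁; _⊆_; _≐_; Empty; Decidable)
open import Relation.Unary.Properties using (∁?)

open import Defs

open Equivalence using (to; from)

-- Counting

-- HasCount of Defs, for an arbitrary carrier.
Count : {A : Set} → Pred A 0ℓ → ℕ → Set
Count {A} P n = Σ[ L ∈ List A ] Unique L × length L ≡ n × (∀ x → x ∈ L ⇔ P x)

module _ {A : Set} where

  count-resp : {P Q : Pred A 0ℓ} {n : ℕ} → P ≐ Q → Count P n → Count Q n
  count-resp (P⊆Q , Q⊆P) (L , u , len , mem) =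
    L , u , len , λ x → mk⇔ (P⊆Q ∘ to (mem x)) (from (mem x) ∘ Q⊆P)

  count-≡ : (a : A) → Count (_≡ a) 1
  count-≡ a = [ a ] , [] ∷ [] , refl , λ x → mk⇔ (λ { (here x≡a) → x≡a ; (there ()) }) here

  count-empty : {P : Pred A 0ℓ} → Empty P → Count P 0
  count-empty ∅ = [] , [] , refl , λ x → mk⇔ (λ ()) (⊥-elim ∘ ∅ x)

  count-∪ : {P Q : Pred A 0ℓ} {a b : ℕ} → Count P a → Count Q b → Empty (P ∩ Q) →
            Count (P ∪ Q) (a + b)
  count-∪ {P} {Q} (L , uL , refl , memL) (M , uM , refl , memM) P∩Q=∅ =
    L ++ M , Unique.++⁺ uL uM (λ (x∈L , x∈M) → P∩Q=∅ _ (to (memL _) x∈L , to (memM _) x∈M)) ,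
    length-++ L , λ x → mk⇔ (split x) λ { (inj₁ p) → ∈-++⁺ˡ (from (memL x) p)
                                        ; (inj₂ q) → ∈-++⁺ʳ L (from (memM x) q) }
    where
    split : ∀ x → x ∈ L ++ M → P x ⊎ Q x
    split x x∈L++M with ∈-++⁻ L x∈L++M
    ... | inj₁ x∈L = inj₁ (to (memL x) x∈L)
    ... | inj₂ x∈M = inj₂ (to (memM x) x∈M)

  count-unique : {P : Pred A 0ℓ} {a b : ℕ} → Count P a → Count P b → a ≡ b
  count-unique (L , uL , refl , memL) (M , uM , refl , memM) =
    ↭-length (∼bag⇒↭ (unique∧set⇒bag uL uM λ {x} →
      mk⇔ (from (memM x) ∘ to (memL x)) (from (memL x) ∘ to (memM x))))

  count-partition : {P Q : Pred A 0ℓ} {n : ℕ} → Decidable Q → Count P n →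
                    ∃₂ λ a b → Count (P ∩ Q) a × Count (P ∩ ∁ Q) b × a + b ≡ n
  count-partition {P} {Q} Q? cP@(L , u , _ , mem) =
    _ , _ , cP∩Q , cP∩∁Q ,
    count-unique (count-resp (merge , split) (count-∪ cP∩Q cP∩∁Q λ _ ((_ , q) , (_ , ¬q)) → ¬q q)) cP
    where
    restrict : {R : Pred A 0ℓ} (R? : Decidable R) → Count (P ∩ R) (length (filter R? L))
    restrict R? = filter R? L , Unique.filter⁺ R? u , refl , λ x →
      mk⇔ (λ x∈ → let (x∈L , r) = ∈-filter⁻ R? x∈ in to (mem x) x∈L , r)
          (λ (p , r) → ∈-filter⁺ R? (from (mem x) p) r)
    cP∩Q = restrict Q?
    cP∩∁Q = restrict (∁? Q?)
    merge : (P ∩ Q) ∪ (P ∩ ∁ Q) ⊆ P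
    merge (inj₁ (p , _)) = p
    merge (inj₂ (p , _)) = p
    split : P ⊆ (P ∩ Q) ∪ (P ∩ ∁ Q)
    split {x} p with Q? x
    ... | yes q = inj₁ (p , q)
    ... | no ¬q = inj₂ (p , ¬q)

Image : {A B : Set} → (A → B) → Pred A 0ℓ → Pred B 0ℓ
Image f P y = ∃[ x ] P x × f x ≡ y

module _ {A B : Set} {P : Pred A 0ℓ} (f : A → B)
         (f-inj : ∀ {x y} → P x → P y → f x ≡ f y → x ≡ y) where

  private
    unique-map : (L : List A) → All P L → Unique L → Unique (map f L)
    unique-map [] [] [] = []
    unique-map (x ∷ L) (px ∷ pL) (x∉L ∷ uL) = separated L pL x∉L ∷ unique-map L pL uL
      where
      separated : (M : List A) → All P M → All (x ≢_) M → All (f x ≢_) (map f M)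
      separated [] [] [] = []
      separated (y ∷ M) (py ∷ pM) (x≢y ∷ x∉M) = (x≢y ∘ f-inj px py) ∷ separated M pM x∉M

  count-image : {n : ℕ} → Count P n → Count (Image f P) n
  count-image (L , u , len , mem) =
    map f L , unique-map L (All.tabulate (to (mem _))) u , trans (length-map f L) len , λ y →
      mk⇔ (λ y∈ → let (x , x∈L , y≡fx) = ∈-map⁻ f y∈ in x , to (mem x) x∈L , sym y≡fx)
          (λ { (x , px , refl) → ∈-map⁺ f (from (mem x) px) })

  count-bijection : {Q : Pred B 0ℓ} {n : ℕ} → Count P n → (∀ {x} → P x → Q (f x)) → Q ⊆ Image f P →
                    Count Q n
  count-bijection cP P⇒Qf Q⇒img =
    count-resp ((λ { (x , px , refl) → P⇒Qf px }) , Q⇒img) (count-image cP)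

module _ {A : Set} {P C : Pred A 0ℓ} (ρ : A → A) (ρ-involutive : ∀ x → ρ (ρ x) ≡ x)
         (ρ-closed : ∀ {x} → P x → P (ρ x)) (C? : Decidable C)
         (C-covers : ∀ {x} → P x → ¬ C x → C (ρ x)) where

  private
    ρ-injective : ∀ {Q : Pred A 0ℓ} {x y} → Q x → Q y → ρ x ≡ ρ y → x ≡ y
    ρ-injective {x = x} {y} _ _ ρx≡ρy =
      trans (sym (ρ-involutive x)) (trans (cong ρ ρx≡ρy) (ρ-involutive y))

    reflected : ∀ {x} → (P ∩ ∁ C) x → ((P ∩ C) ∩ ∁ (C ∘ ρ)) (ρ x)
    reflected {x} (p , ¬c) = (ρ-closed p , C-covers p ¬c) , ¬c ∘ subst C (ρ-involutive x)

    unreflected : (P ∩ C) ∩ ∁ (C ∘ ρ) ⊆ Image ρ (P ∩ ∁ C)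
    unreflected {y} ((p , _) , ¬cρ) = ρ y , (ρ-closed p , ¬cρ) , ρ-involutive y

    double-count : ∀ k d → (k + d) + d + k ≡ 2 * (k + d)
    double-count = solve-∀

  -- ρ maps P ∩ ∁ C bijectively onto the elements of P ∩ C whose image is not in C.
  count-orbit-representatives : ∀ {N k} → Count P N → Count ((P ∩ C) ∩ (C ∘ ρ)) k →
                                ∃[ c ] Count (P ∩ C) c × N + k ≡ 2 * c
  count-orbit-representatives {k = k} cP cFixed
    with a , b , cP∩C , cP∩∁C , refl ← count-partition C? cP
    with k' , d , cFixed' , cFree , refl ← count-partition (C? ∘ ρ) cP∩C
    with refl ← count-unique cFixed' cFixed
    with refl ← count-unique cFree (count-bijection ρ ρ-injective cP∩∁C reflected unreflected) =
    k + d , cP∩C , double-count k d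

-- Paths as vertex sequences

Path : {V : Set} → (V → V → Set) → List V → Set
Path R w = Linked R w × Unique w

module _ {V : Set} {R : V → V → Set} where

  path-[] : Path R []
  path-[] = [] , []

  path-[-] : {x : V} → Path R [ x ]
  path-[-] = [-] , [] ∷ []

  path-∷ : ∀ {x y w} → R x y → x ∉ y ∷ w → Path R (y ∷ w) → Path R (x ∷ y ∷ w)
  path-∷ xRy x∉ (linked , unique) = xRy ∷ linked , ¬Any⇒All¬ _ x∉ ∷ unique

  path-step : ∀ {x y w} → Path R (x ∷ y ∷ w) → R x y
  path-step = Linked.head ∘ proj₁

  path-tail : ∀ {x w} → Path R (x ∷ w) → Path R w
  path-tail (linked , _ ∷ unique) = Linked.tail linked , unique

  path-head∉ : ∀ {x w} → Path R (x ∷ w) → x ∉ w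
  path-head∉ (_ , x∉ ∷ _) = All¬⇒¬Any x∉

  path-++⁻ˡ : ∀ w {w'} → Path R (w ++ w') → Path R w
  path-++⁻ˡ []          _ = path-[]
  path-++⁻ˡ (x ∷ [])    _ = path-[-]
  path-++⁻ˡ (x ∷ y ∷ w) p =
    path-∷ (path-step p) (path-head∉ p ∘ ∈-++⁺ˡ) (path-++⁻ˡ (y ∷ w) (path-tail p))

module _ {V W : Set} {R : V → V → Set} {S : W → W → Set} {f : V → W} where

  path-map : Injective _≡_ _≡_ f → (∀ {x y} → R x y → S (f x) (f y)) →
             ∀ {w} → Path R w → Path S (map f w)
  path-map f-inj f-hom (linked , unique) = Linkedₚ.map⁺ (Linked.map f-hom linked) , Unique.map⁺ f-inj unique

  path-map⁻ : (∀ {x y} → S (f x) (f y) → R x y) → ∀ {w} → Path S (map f w) → Path R w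
  path-map⁻ f-hom⁻ (linked , unique) = Linked.map f-hom⁻ (Linkedₚ.map⁻ linked) , Unique.map⁻ unique

module _ {A : Set} where

  ∈-ʳ++⁺ˡ : ∀ {v : A} {α β} → v ∈ α → v ∈ α ʳ++ β
  ∈-ʳ++⁺ˡ v∈α = Any.reverseAcc⁺ _ _ (inj₂ v∈α)

  ∈-ʳ++⁺ʳ : ∀ {v : A} α {β} → v ∈ β → v ∈ α ʳ++ β
  ∈-ʳ++⁺ʳ α v∈β = Any.reverseAcc⁺ _ α (inj₁ v∈β)

  ∈-ʳ++⁻ : ∀ {v : A} α {β} → v ∈ α ʳ++ β → v ∈ α ⊎ v ∈ β
  ∈-ʳ++⁻ α v∈ with Any.reverseAcc⁻ _ α v∈
  ... | inj₁ v∈β = inj₂ v∈β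
  ... | inj₂ v∈α = inj₁ v∈α

  ++-∷-cancel : ∀ {x : A} p p' {s s'} → x ∉ p → x ∉ p' →
                p ++ x ∷ s ≡ p' ++ x ∷ s' → p ≡ p' × s ≡ s'
  ++-∷-cancel []      []       _    _     eq = refl , proj₂ (∷-injective eq)
  ++-∷-cancel []      (_ ∷ _)  _    x∉p' eq = ⊥-elim (x∉p' (here (proj₁ (∷-injective eq))))
  ++-∷-cancel (_ ∷ _) []       x∉p  _    eq = ⊥-elim (x∉p (here (sym (proj₁ (∷-injective eq)))))
  ++-∷-cancel (a ∷ p) (a' ∷ p') x∉p x∉p' eq with refl , eq' ← ∷-injective eq =
    let p≡p' , s≡s' = ++-∷-cancel p p' (x∉p ∘ there) (x∉p' ∘ there) eq'
    in cong (a ∷_) p≡p' , s≡s'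

  head-ʳ++ : ∀ (x : A) t acc → ∃[ y ] head ((x ∷ t) ʳ++ acc) ≡ just y × y ∈ x ∷ t
  head-ʳ++ x []      acc = x , refl , here refl
  head-ʳ++ x (z ∷ t) acc = let y , eq , y∈ = head-ʳ++ z t (x ∷ acc) in y , eq , there y∈

  reverse≢[] : ∀ {w : List A} → w ≢ [] → reverse w ≢ []
  reverse≢[] w≢[] = w≢[] ∘ reverse-injective

  ʳ++-∷-cancel : ∀ {x : A} α α' {β β'} → x ∉ α → x ∉ α' →
                 α ʳ++ x ∷ β ≡ α' ʳ++ x ∷ β' → α ≡ α' × β ≡ β'
  ʳ++-∷-cancel α α' x∉α x∉α' eq =
    let rα≡rα' , β≡β' =
          ++-∷-cancel (reverse α) (reverse α') (x∉α ∘ Any.reverse⁻) (x∉α' ∘ Any.reverse⁻)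
                      (trans (sym (ʳ++-defn α)) (trans eq (ʳ++-defn α')))
    in reverse-injective rα≡rα' , β≡β'

module SymmetricPaths {V : Set} {R : V → V → Set} (R-sym : Symmetric R) where

  Fork : V → List V × List V → Set
  Fork x (α , β) = Path R (x ∷ α) × Path R (x ∷ β) × Disjoint α β

  fork-swap : ∀ {x α β} → Fork x (α , β) → Fork x (β , α)
  fork-swap (xα , xβ , α#β) = xβ , xα , Disjoint.sym α#β

  glue : V → List V × List V → List V
  glue x (α , β) = α ʳ++ x ∷ β

  path-glue : ∀ {x} α {β} → Fork x (α , β) → Path R (α ʳ++ x ∷ β)
  path-glue []           (_ , xβ , _) = xβ
  path-glue {x} (a ∷ α) {β} (xaα , xβ , aα#β) =
    path-glue α (path-tail xaα , path-∷ (R-sym (path-step xaα)) a∉xβ xβ , α#xβ)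
    where
    a∉xβ : a ∉ x ∷ β
    a∉xβ (here refl) = path-head∉ xaα (here refl)
    a∉xβ (there a∈β) = aα#β (here refl , a∈β)
    α#xβ : Disjoint α (x ∷ β)
    α#xβ (v∈α , here refl) = path-head∉ xaα (there v∈α)
    α#xβ (v∈α , there v∈β) = aα#β (there v∈α , v∈β)

  path-glue⁻ : ∀ {x} α {β} → Path R (α ʳ++ x ∷ β) → Fork x (α , β)
  path-glue⁻ []            xβ = path-[-] , xβ , λ ()
  path-glue⁻ {x} (a ∷ α) {β} p with aα , axβ , α#xβ ← path-glue⁻ α p =
    path-∷ (R-sym (path-step axβ)) x∉aα aα , path-tail axβ , aα#β
    where
    x∉aα : x ∉ a ∷ α
    x∉aα (here refl) = path-head∉ axβ (here refl)
    x∉aα (there x∈α) = α#xβ (x∈α , here refl)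
    aα#β : Disjoint (a ∷ α) β
    aα#β (here refl , v∈β) = path-head∉ axβ (there v∈β)
    aα#β (there v∈α , v∈β) = α#xβ (v∈α , there v∈β)

  path-reverse : ∀ {w} → Path R w → Path R (reverse w)
  path-reverse {[]}    _ = path-[]
  path-reverse {x ∷ α} p = path-glue α (p , path-[-] , λ ())

  path-between : ∀ {a b c w} → Path R (a ∷ c ∷ w) → Path R (b ∷ reverse (c ∷ w)) → a ≢ b →
                 Path R (a ∷ c ∷ (w ∷ʳ b))
  path-between {a} {b} {c} {w} acw b-rev-cw a≢b = path-glue [ a ] (ca , cwb , a#wb)
    where
    ca : Path R (c ∷ a ∷ [])
    ca = path-∷ (R-sym (path-step acw))
                (λ { (here c≡a) → path-head∉ acw (here (sym c≡a)) ; (there ()) }) path-[-]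
    cwb : Path R (c ∷ (w ∷ʳ b))
    cwb = subst (Path R)
                (trans (unfold-reverse b (reverse (c ∷ w))) (cong (_∷ʳ b) (reverse-involutive (c ∷ w))))
                (path-reverse b-rev-cw)
    a#wb : Disjoint [ a ] (w ∷ʳ b)
    a#wb (here refl , a∈wb) with ∈-++⁻ w a∈wb
    ... | inj₁ a∈w          = path-head∉ acw (there a∈w)
    ... | inj₂ (here a≡b)   = a≢b a≡b

  path-split : ∀ {x w} → Path R w → x ∈ w → ∃[ p ] Fork x p × glue x p ≡ w
  path-split {x} p x∈w with pre , suf , refl ← ∈-∃++ x∈w =
    (reverse pre , suf) , path-glue⁻ (reverse pre) (subst (Path R) (sym glued) p) , glued
    where
    glued : reverse pre ʳ++ x ∷ suf ≡ pre ++ x ∷ suf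
    glued = trans (ʳ++-defn (reverse pre)) (cong (_++ x ∷ suf) (reverse-involutive pre))

  count-paths-through : ∀ {x} {Q : Pred (List V) 0ℓ} {n} →
    Count (λ p → Fork x p × Q (glue x p)) n → Count (λ w → Path R w × x ∈ w × Q w) n
  count-paths-through {x} {Q} c =
    count-bijection (glue x) glue-injective c
      (λ { {α , _} (fork , q) → path-glue α fork , ∈-ʳ++⁺ʳ α (here refl) , q })
      (λ (path , x∈w , q) → let p , fork , glued = path-split path x∈w in
                            p , (fork , subst Q (sym glued) q) , glued)
    where
    glue-injective : ∀ {p p'} → Fork x p × Q (glue x p) → Fork x p' × Q (glue x p') →
                     glue x p ≡ glue x p' → p ≡ p'
    glue-injective {α , β} {α' , β'} ((xα , _) , _) ((xα' , _) , _) eq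
      with refl , refl ← ʳ++-∷-cancel α α' (path-head∉ xα) (path-head∉ xα') eq = refl

module _ {V W : Set} {R : V → V → Set} {S : W → W → Set} (f : V → W) (g : W → V)
         (g∘f : ∀ x → g (f x) ≡ x) (f∘g : ∀ y → f (g y) ≡ y)
         (f-hom : ∀ {x y} → R x y ⇔ S (f x) (f y)) where

  count-paths-transfer : ∀ {n} → Count (Path R) n → Count (Path S) n
  count-paths-transfer c = count-bijection (map f) (λ _ _ → map-injective f-injective) c
    (path-map f-injective (to f-hom))
    (λ {w} path → map g w , path-map g-injective g-hom path , map-inverse w)
    where
    f-injective : Injective _≡_ _≡_ f
    f-injective {x} {y} fx≡fy = trans (sym (g∘f x)) (trans (cong g fx≡fy) (g∘f y))
    g-injective : Injective _≡_ _≡_ g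
    g-injective {x} {y} gx≡gy = trans (sym (f∘g x)) (trans (cong f gx≡gy) (f∘g y))
    g-hom : ∀ {x y} → S x y → R (g x) (g y)
    g-hom {x} {y} s = from f-hom (subst₂ S (sym (f∘g x)) (sym (f∘g y)) s)
    map-inverse : ∀ w → map f (map g w) ≡ w
    map-inverse w = trans (sym (map-∘ w)) (trans (map-cong f∘g w) (map-id w))

-- Paths as subgraphs

module _ {A : Set} where

  data Link (u v : A) : List A → Set where
    here  : ∀ {w} → Link u v (u ∷ v ∷ w)
    there : ∀ {x w} → Link u v w → Link u v (x ∷ w)

  Edge : List A → A → A → Set
  Edge w u v = Link u v w ⊎ Link v u w

  link-∈ : ∀ {u v w} → Link u v w → u ∈ w × v ∈ w
  link-∈ here      = here refl , there (here refl)
  link-∈ (there l) = let u∈ , v∈ = link-∈ l in there u∈ , there v∈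

  edge-∈ : ∀ {u v w} → Edge w u v → u ∈ w × v ∈ w
  edge-∈ (inj₁ l) = link-∈ l
  edge-∈ (inj₂ l) = let v∈ , u∈ = link-∈ l in u∈ , v∈

  link-++ : ∀ {u v w} p → Link u v w → Link u v (p ++ w)
  link-++ []      l = l
  link-++ (_ ∷ p) l = there (link-++ p l)

  link-ʳ++ʳ : ∀ {u v β} α → Link u v β → Link u v (α ʳ++ β)
  link-ʳ++ʳ []      l = l
  link-ʳ++ʳ (_ ∷ α) l = link-ʳ++ʳ α (there l)

  link-ʳ++ˡ : ∀ {u v α β} → Link u v α → Link v u (α ʳ++ β)
  link-ʳ++ˡ {α = _ ∷ _ ∷ α} here = link-ʳ++ʳ α here
  link-ʳ++ˡ (there l)             = link-ʳ++ˡ l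

  edge-reverse : ∀ {w u v} → Edge w u v → Edge (reverse w) u v
  edge-reverse (inj₁ l) = inj₂ (link-ʳ++ˡ l)
  edge-reverse (inj₂ l) = inj₁ (link-ʳ++ˡ l)

  edge-reverse⁻ : ∀ {w u v} → Edge (reverse w) u v → Edge w u v
  edge-reverse⁻ {w} = subst (λ w → Edge w _ _) (reverse-involutive w) ∘ edge-reverse

  module _ (_≟ᴬ_ : DecidableEquality A) where

    link? : ∀ u v w → Dec (Link u v w)
    link? u v []          = no λ ()
    link? u v (x ∷ [])    = no λ { (there ()) }
    link? u v (x ∷ y ∷ w) with x ≟ᴬ u | y ≟ᴬ v | link? u v (y ∷ w)
    ... | yes refl | yes refl | _      = yes here
    ... | _        | _        | yes l  = yes (there l)
    ... | no x≢u   | _        | no ¬l  = no λ { here → x≢u refl ; (there l) → ¬l l }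
    ... | yes _    | no y≢v   | no ¬l  = no λ { here → y≢v refl ; (there l) → ¬l l }

    edge? : ∀ w u v → Dec (Edge w u v)
    edge? w u v = link? u v w ⊎-dec link? v u w

does≡true⇔ : {P : Set} (P? : Dec P) → does P? ≡ true ⇔ P
does≡true⇔ (yes p) = mk⇔ (λ _ → p) (λ _ → refl)
does≡true⇔ (no ¬p) = mk⇔ (λ ()) (⊥-elim ∘ ¬p)

vec-ext : ∀ {A : Set} {n} {xs ys : Vec A n} → (∀ i → lookup xs i ≡ lookup ys i) → xs ≡ ys
vec-ext {xs = xs} {ys} eq = trans (sym (tabulate∘lookup xs)) (trans (tabulate-cong eq) (tabulate∘lookup ys))

module _ {n : ℕ} where

  open DecMembership (Fin._≟_ {n}) using (_∈?_)

  trace : List (Fin n) → Subgraph n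
  trace w = tabulate (λ v → does (v ∈? w)) ,
            tabulate (λ u → tabulate (λ v → does (edge? Fin._≟_ w u v)))

  InV-trace : ∀ w v → InV (trace w) v ⇔ v ∈ w
  InV-trace w v = subst (λ b → b ≡ true ⇔ v ∈ w) (sym (lookup∘tabulate _ v)) (does≡true⇔ (v ∈? w))

  InE-trace : ∀ w u v → InE (trace w) u v ⇔ Edge w u v
  InE-trace w u v =
    subst (λ b → b ≡ true ⇔ Edge w u v)
      (sym (trans (cong (λ row → lookup row v) (lookup∘tabulate _ u)) (lookup∘tabulate _ v)))
      (does≡true⇔ (edge? Fin._≟_ w u v))

  subgraph-ext : {H H' : Subgraph n} → (∀ v → InV H v ⇔ InV H' v) → (∀ u v → InE H u v ⇔ InE H' u v) →
                 H ≡ H'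
  subgraph-ext {S , E} {S' , E'} eqV eqE =
    cong₂ _,_ (vec-ext λ v → ⇔→≡ (eqV v)) (vec-ext λ u → vec-ext λ v → ⇔→≡ (eqE u v))

  trace-reverse : ∀ w → trace (reverse w) ≡ trace w
  trace-reverse w = subgraph-ext
    (λ v → ⇔-trans (InV-trace (reverse w) v)
                   (⇔-trans (mk⇔ Any.reverse⁻ Any.reverse⁺) (⇔-sym (InV-trace w v))))
    (λ u v → ⇔-trans (InE-trace (reverse w) u v)
                     (⇔-trans (mk⇔ edge-reverse⁻ edge-reverse) (⇔-sym (InE-trace w u v))))

module _ {A : Set} where

  link-tabulate⁺ : ∀ {m} (f : Fin (suc m) → A) i → Link (f (inject₁ i)) (f (suc i)) (List.tabulate f)
  link-tabulate⁺ {suc m} f zero    = here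
  link-tabulate⁺ {suc m} f (suc i) = there (link-tabulate⁺ (f ∘ suc) i)

  link-tabulate⁻ : ∀ {m} (f : Fin (suc m) → A) {u v} → Link u v (List.tabulate f) →
                   ∃[ i ] f (inject₁ i) ≡ u × f (suc i) ≡ v
  link-tabulate⁻ {zero}  f (there ())
  link-tabulate⁻ {suc m} f here      = zero , refl , refl
  link-tabulate⁻ {suc m} f (there l) =
    let i , eq₁ , eq₂ = link-tabulate⁻ (f ∘ suc) l in suc i , eq₁ , eq₂

  linked-tabulate⁺ : ∀ {R : A → A → Set} {m} (f : Fin (suc m) → A) →
                     (∀ i → R (f (inject₁ i)) (f (suc i))) → Linked R (List.tabulate f)
  linked-tabulate⁺ {m = zero}  f steps = [-]
  linked-tabulate⁺ {m = suc m} f steps = steps zero ∷ linked-tabulate⁺ (f ∘ suc) (steps ∘ suc)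

  linked-tabulate⁻ : ∀ {R : A → A → Set} {m} (f : Fin (suc m) → A) →
                     Linked R (List.tabulate f) → ∀ i → R (f (inject₁ i)) (f (suc i))
  linked-tabulate⁻ {m = suc m} f (r ∷ _) zero    = r
  linked-tabulate⁻ {m = suc m} f (_ ∷ l) (suc i) = linked-tabulate⁻ (f ∘ suc) l i

  unique-tabulate⁻ : ∀ {m} (f : Fin m → A) → Unique (List.tabulate f) → Injective _≡_ _≡_ f
  unique-tabulate⁻ f u {zero}  {zero}  _ = refl
  unique-tabulate⁻ f (f0∉ ∷ _) {zero}  {suc j} f0≡fj =
    ⊥-elim (All¬⇒¬Any f0∉ (subst (_∈ List.tabulate (f ∘ suc)) (sym f0≡fj) (∈-tabulate⁺ j)))
  unique-tabulate⁻ f (f0∉ ∷ _) {suc i} {zero}  fi≡f0 =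
    ⊥-elim (All¬⇒¬Any f0∉ (subst (_∈ List.tabulate (f ∘ suc)) fi≡f0 (∈-tabulate⁺ i)))
  unique-tabulate⁻ f (_ ∷ u)   {suc i} {suc j} fi≡fj = cong suc (unique-tabulate⁻ (f ∘ suc) u fi≡fj)

module _ {n : ℕ} (G : Graph n) where

  private
    Traverses : ∀ {m} → (Fin (suc m) → Fin n) → Fin n → Fin n → Set
    Traverses {m} f u v =
      ∃[ i ] ((f (inject₁ i) ≡ u × f (suc i) ≡ v) ⊎ (f (inject₁ i) ≡ v × f (suc i) ≡ u))

  InV-trace-tabulate : ∀ {m} (f : Fin m → Fin n) v → InV (trace (List.tabulate f)) v ⇔ (∃[ i ] f i ≡ v)
  InV-trace-tabulate f v = ⇔-trans (InV-trace _ v)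
    (mk⇔ (λ v∈ → let i , v≡fi = ∈-tabulate⁻ v∈ in i , sym v≡fi)
         λ { (i , refl) → ∈-tabulate⁺ i })

  InE-trace-tabulate : ∀ {m} (f : Fin (suc m) → Fin n) u v →
                       InE (trace (List.tabulate f)) u v ⇔ Traverses f u v
  InE-trace-tabulate f u v = ⇔-trans (InE-trace _ u v) (mk⇔ traversal edge)
    where
    traversal : Edge (List.tabulate f) u v → Traverses f u v
    traversal (inj₁ l) = let i , eq₁ , eq₂ = link-tabulate⁻ f l in i , inj₁ (eq₁ , eq₂)
    traversal (inj₂ l) = let i , eq₁ , eq₂ = link-tabulate⁻ f l in i , inj₂ (eq₁ , eq₂)
    edge : Traverses f u v → Edge (List.tabulate f) u v
    edge (i , inj₁ (refl , refl)) = inj₁ (link-tabulate⁺ f i)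
    edge (i , inj₂ (refl , refl)) = inj₂ (link-tabulate⁺ f i)

  tabulate-IsPathIn : ∀ {m} (f : Fin (suc m) → Fin n) → Path (Adj G) (List.tabulate f) →
                      IsPathIn G (trace (List.tabulate f))
  tabulate-IsPathIn {m} f (linked , unique) =
    m , f , unique-tabulate⁻ f unique , linked-tabulate⁻ f linked , InV-trace-tabulate f , InE-trace-tabulate f

  path-IsPathIn : ∀ {x t} → Path (Adj G) (x ∷ t) → IsPathIn G (trace (x ∷ t))
  path-IsPathIn {x} {t} p =
    subst (IsPathIn G ∘ trace) (tabulate-lookup (x ∷ t))
      (tabulate-IsPathIn (List.lookup (x ∷ t)) (subst (Path (Adj G)) (sym (tabulate-lookup (x ∷ t))) p))

  IsPathIn-trace : ∀ {H} → IsPathIn G H → ∃[ w ] (Path (Adj G) w × w ≢ []) × trace w ≡ H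
  IsPathIn-trace (m , f , f-injective , steps , vertices , edges) =
    List.tabulate f , ((linked-tabulate⁺ f steps , Unique.tabulate⁺ f-injective) , λ ()) ,
    subgraph-ext (λ v → ⇔-trans (InV-trace-tabulate f v) (⇔-sym (vertices v)))
                 (λ u v → ⇔-trans (InE-trace-tabulate f u v) (⇔-sym (edges u v)))

module _ {A : Set} where

  unique-reverse : ∀ {w : List A} → Unique w → Unique (reverse w)
  unique-reverse {w} = Unique-resp-↭ (↭⇒↭ₛ (↭-sym (↭-reverse w)))
    where open Permutationₛ (setoid A) using (Unique-resp-↭)

  unique-++-disjoint : ∀ (p : List A) {q} → Unique (p ++ q) → Disjoint p q
  unique-++-disjoint (x ∷ p) (x∉ ∷ _) (here refl , v∈q)  = All¬⇒¬Any x∉ (∈-++⁺ʳ p v∈q)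
  unique-++-disjoint (x ∷ p) (_ ∷ u)  (there v∈p , v∈q) = unique-++-disjoint p u (v∈p , v∈q)

  _⊆ₑ_ : List A → List A → Set
  w ⊆ₑ w' = ∀ {u v} → Edge w u v → Edge w' u v

  no-edge-[-] : ∀ {x u v : A} → ¬ Edge [ x ] u v
  no-edge-[-] (inj₁ (there ()))
  no-edge-[-] (inj₂ (there ()))

  edge-at-head : ∀ {h z : A} {t} → Unique (h ∷ t) → Edge (h ∷ t) h z → head t ≡ just z
  edge-at-head _         (inj₁ here)      = refl
  edge-at-head (h∉t ∷ _) (inj₁ (there l)) = ⊥-elim (All¬⇒¬Any h∉t (proj₁ (link-∈ l)))
  edge-at-head (h∉t ∷ _) (inj₂ here)      = ⊥-elim (All¬⇒¬Any h∉t (here refl))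
  edge-at-head (h∉t ∷ _) (inj₂ (there l)) = ⊥-elim (All¬⇒¬Any h∉t (proj₂ (link-∈ l)))

  ⊆ₑ-tail : ∀ {x y : A} {t t'} → Unique (x ∷ y ∷ t) → (x ∷ y ∷ t) ⊆ₑ (x ∷ y ∷ t') →
            (y ∷ t) ⊆ₑ (y ∷ t')
  ⊆ₑ-tail (x∉ ∷ _) fwd e with fwd (Sum.map there there e)
  ... | inj₁ here      = ⊥-elim (All¬⇒¬Any x∉ (proj₁ (edge-∈ e)))
  ... | inj₂ here      = ⊥-elim (All¬⇒¬Any x∉ (proj₂ (edge-∈ e)))
  ... | inj₁ (there l) = inj₁ l
  ... | inj₂ (there l) = inj₂ l

  edges-determine-from-head : ∀ {x : A} t t' → Unique (x ∷ t) → Unique (x ∷ t') →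
                              (x ∷ t) ⊆ₑ (x ∷ t') → (x ∷ t') ⊆ₑ (x ∷ t) → t ≡ t'
  edges-determine-from-head []      []       _ _ _ _ = refl
  edges-determine-from-head []      (_ ∷ _)  _ _ _ bwd = ⊥-elim (no-edge-[-] (bwd (inj₁ here)))
  edges-determine-from-head (_ ∷ _) []       _ _ fwd _ = ⊥-elim (no-edge-[-] (fwd (inj₁ here)))
  edges-determine-from-head (y ∷ t) (y' ∷ t') u@(_ ∷ uₜ) u'@(_ ∷ uₜ') fwd bwd
    with refl ← just-injective (edge-at-head u' (fwd (inj₁ here))) =
    cong (y ∷_) (edges-determine-from-head t t' uₜ uₜ' (⊆ₑ-tail u fwd) (⊆ₑ-tail u' bwd))

  -- The head h of the second list has only one neighbour there, so it must be an end of w.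
  edges-determine-up-to-reverse : ∀ {w h t'} → Unique w → Unique (h ∷ t') → h ∈ w →
                                  w ⊆ₑ (h ∷ t') → (h ∷ t') ⊆ₑ w →
                                  h ∷ t' ≡ w ⊎ h ∷ t' ≡ reverse w
  edges-determine-up-to-reverse {h = h} {t'} u u' h∈w fwd bwd
    with p , s , refl ← ∈-∃++ h∈w with reverseView p | s
  ... | []            | s       = inj₁ (cong (h ∷_) (sym (edges-determine-from-head s t' u u' fwd bwd)))
  ... | p₀ ∶ _ ∶ʳ a   | b ∷ s'  =
    ⊥-elim (unique-++-disjoint (p₀ ∷ʳ a) u (∈-++⁺ʳ p₀ (here refl) , there (here a≡b)))
    where
    a-h : Link a h ((p₀ ∷ʳ a) ++ h ∷ b ∷ s')
    a-h = subst (Link a h) (sym (++-assoc p₀ [ a ] (h ∷ b ∷ s'))) (link-++ p₀ here)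
    a≡b : a ≡ b
    a≡b = just-injective (trans (sym (edge-at-head u' (fwd (inj₂ a-h))))
                                (edge-at-head u' (fwd (inj₁ (link-++ (p₀ ∷ʳ a) here)))))
  ... | p₀ ∶ _ ∶ʳ a   | []      = inj₂ (trans (cong (h ∷_) (sym r≡t')) (sym reversed))
    where
    r = reverse (p₀ ∷ʳ a)
    reversed : reverse ((p₀ ∷ʳ a) ++ [ h ]) ≡ h ∷ r
    reversed = reverse-++ (p₀ ∷ʳ a) [ h ]
    r≡t' : r ≡ t'
    r≡t' = edges-determine-from-head r t' (subst Unique reversed (unique-reverse u)) u'
      (fwd ∘ edge-reverse⁻ ∘ subst (λ w → Edge w _ _) (sym reversed))
      (subst (λ w → Edge w _ _) reversed ∘ edge-reverse ∘ bwd)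

module _ {n : ℕ} where

  -- Selects one of the two traversals of each path subgraph with at least two vertices.
  Oriented : Pred (List (Fin n)) 0ℓ
  Oriented w = Pointwise Fin._≤_ (head w) (head (reverse w))

  oriented? : Decidable Oriented
  oriented? w = Pointwise.dec Finₚ._≤?_ (head w) (head (reverse w))

  reverse-oriented : ∀ w → w ≢ [] → ¬ Oriented w → Oriented (reverse w)
  reverse-oriented []      []≢[] _ = ⊥-elim ([]≢[] refl)
  reverse-oriented (x ∷ t) _ ¬oriented with y , eq , _ ← head-ʳ++ x t [] =
    subst₂ (Pointwise Fin._≤_) (sym eq) (cong head (sym (reverse-involutive (x ∷ t))))
      (just ([ (λ x≤y → ⊥-elim (¬oriented (subst (Pointwise Fin._≤_ (just x)) (sym eq) (just x≤y)))) , id ]′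
               (Finₚ.≤-total x y)))

  oriented-both-ways : ∀ {w} → Unique w → w ≢ [] → Oriented w → Oriented (reverse w) →
                       ∃[ v ] [ v ] ≡ w
  oriented-both-ways {[]}         _ []≢[] _ _ = ⊥-elim ([]≢[] refl)
  oriented-both-ways {x ∷ []}     _ _ _ _ = x , refl
  oriented-both-ways {x ∷ z ∷ t} (x∉ ∷ _) _ oriented oriented-back
    with y , eq , y∈ ← head-ʳ++ z t [ x ]
    with just x≤y ← subst (Pointwise Fin._≤_ (just x)) eq oriented
    with just y≤x ← subst₂ (Pointwise Fin._≤_) eq (cong head (reverse-involutive (x ∷ z ∷ t)))
                           oriented-back =
    ⊥-elim (All¬⇒¬Any x∉ (subst (_∈ z ∷ t) (Finₚ.≤-antisym y≤x x≤y) y∈))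

module _ {n : ℕ} (G : Graph n) (G-sym : Symmetric (Adj G)) where

  open SymmetricPaths {Fin n} {Adj G} G-sym using (path-reverse)

  private
    NonemptyPath : Pred (List (Fin n)) 0ℓ
    NonemptyPath = Path (Adj G) ∩ ∁ (_≡ [])

    empty? : Decidable {A = List (Fin n)} (_≡ [])
    empty? []      = yes refl
    empty? (_ ∷ _) = no λ ()

    count-Fin : Count {Fin n} (λ _ → ⊤) n
    count-Fin = allFin n , Unique.allFin⁺ n , length-tabulate id , λ v → mk⇔ _ (λ _ → ∈-allFin v)

    count-singletons : Count ((NonemptyPath ∩ Oriented) ∩ (Oriented ∘ reverse)) n
    count-singletons = count-bijection [_] (λ _ _ → proj₁ ∘ ∷-injective) count-Fin
      (λ _ → ((path-[-] , λ ()) , just Finₚ.≤-refl) , just Finₚ.≤-refl)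
      (λ (((path , nonempty) , oriented) , oriented-back) →
         let v , eq = oriented-both-ways (proj₂ path) nonempty oriented oriented-back in v , tt , eq)

    nonempty-IsPathIn : ∀ {w} → NonemptyPath w → IsPathIn G (trace w)
    nonempty-IsPathIn {[]}    (_ , []≢[]) = ⊥-elim ([]≢[] refl)
    nonempty-IsPathIn {_ ∷ _} (path , _)  = path-IsPathIn G path

    trace-injective : ∀ {w w'} → (NonemptyPath ∩ Oriented) w → (NonemptyPath ∩ Oriented) w' →
                      trace w ≡ trace w' → w ≡ w'
    trace-injective {w} {[]} _ ((_ , []≢[]) , _) _ = ⊥-elim ([]≢[] refl)
    trace-injective {w} {h ∷ t'} (((_ , unique) , nonempty) , oriented) (((_ , unique') , _) , oriented') eq
      with edges-determine-up-to-reverse unique unique' (same-vertices (here refl))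
                                         (same-edges eq) (same-edges (sym eq))
      where
      same-vertices : ∀ {v} → v ∈ h ∷ t' → v ∈ w
      same-vertices {v} =
        to (InV-trace w v) ∘ subst (λ H → InV H v) (sym eq) ∘ from (InV-trace (h ∷ t') v)
      same-edges : ∀ {w w'} → trace w ≡ trace w' → w ⊆ₑ w'
      same-edges {w} {w'} eq {u} {v} =
        to (InE-trace w' u v) ∘ subst (λ H → InE H u v) eq ∘ from (InE-trace w u v)
    ... | inj₁ w'≡w = sym w'≡w
    ... | inj₂ w'≡rw
      with v , refl ← oriented-both-ways unique nonempty oriented (subst Oriented w'≡rw oriented') =
      sym w'≡rw

    trace-onto : ∀ {H} → IsPathIn G H → ∃[ w ] (NonemptyPath ∩ Oriented) w × trace w ≡ H
    trace-onto isPath with w , (path , nonempty) , traced ← IsPathIn-trace G isPath with oriented? w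
    ... | yes oriented  = w , ((path , nonempty) , oriented) , traced
    ... | no ¬oriented  = reverse w ,
          ((path-reverse path , reverse≢[] nonempty) , reverse-oriented w nonempty ¬oriented) ,
          trans (trace-reverse w) traced

  -- The 1 is the empty sequence; the n one-vertex sequences are the ones equal to their reversal.
  subpathNumber-from-paths : ∀ {W} → Count (Path (Adj G)) W →
                             ∃[ c ] SubpathNumber G c × W + n ≡ 1 + 2 * c
  subpathNumber-from-paths cPaths
    with e , N , cEmpty , cNonempty , refl ← count-partition empty? cPaths
    with refl ← count-unique cEmpty (count-resp ((λ { refl → path-[] , refl }) , proj₂) (count-≡ []))
    with c , cOriented , N+n≡2c ← count-orbit-representatives reverse reverse-involutive
           (λ (path , nonempty) → path-reverse path , reverse≢[] nonempty) oriented?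
           (λ (_ , nonempty) → reverse-oriented _ nonempty) cNonempty count-singletons =
    c , count-bijection trace trace-injective cOriented (nonempty-IsPathIn ∘ proj₁) trace-onto ,
    cong suc N+n≡2c

-- The ladder

-- A vertex of the ladder with n rungs is (row , column). The ladder with n + 1 rungs is the one with
-- n rungs moved one column to the right by shift, plus the rung in column 0 joining its two corners.
Vertex : ℕ → Set
Vertex n = Bool × Fin n

data Consecutive : ∀ {n} → Fin n → Fin n → Set where
  0~1     : ∀ {n} → Consecutive {suc (suc n)} zero (suc zero)
  1~0     : ∀ {n} → Consecutive {suc (suc n)} (suc zero) zero
  suc~suc : ∀ {n} {i j : Fin n} → Consecutive i j → Consecutive (suc i) (suc j)

data Adjacent {n : ℕ} : Vertex n → Vertex n → Set where
  rung : ∀ {r i} → Adjacent (r , i) (not r , i)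
  rail : ∀ {r i j} → Consecutive i j → Adjacent (r , i) (r , j)

consecutive-sym : ∀ {n} {i j : Fin n} → Consecutive i j → Consecutive j i
consecutive-sym 0~1         = 1~0
consecutive-sym 1~0         = 0~1
consecutive-sym (suc~suc c) = suc~suc (consecutive-sym c)

adjacent-sym : ∀ {n} {u v : Vertex n} → Adjacent u v → Adjacent v u
adjacent-sym (rung {false}) = rung
adjacent-sym (rung {true})  = rung
adjacent-sym (rail c)       = rail (consecutive-sym c)

module _ {n : ℕ} where
  open SymmetricPaths {Vertex n} {Adjacent} adjacent-sym public

_≟ᵥ_ : ∀ {n} → DecidableEquality (Vertex n)
_≟ᵥ_ {n} = ≡-dec Bool._≟_ (Fin._≟_ {n})

corner : ∀ {n} → Bool → Vertex (suc n)
corner r = r , zero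

shift : ∀ {n} → Vertex n → Vertex (suc n)
shift (r , i) = r , suc i

shifts : ∀ {n} → List (Vertex n) → List (Vertex (suc n))
shifts = map shift

data StartsAtCorner : ∀ {n} → Bool → List (Vertex n) → Set where
  start : ∀ {n r} {w : List (Vertex (suc n))} → StartsAtCorner r ((r , zero) ∷ w)

module _ {n : ℕ} where

  FromCorner : Bool → Pred (List (Vertex n)) 0ℓ
  FromCorner r w = Path Adjacent w × StartsAtCorner r w

  Leg : Bool → Pred (List (Vertex n)) 0ℓ
  Leg r w = w ≡ [] ⊎ FromCorner r w

  Crossing : Bool → Pred (List (Vertex n)) 0ℓ
  Crossing r w = FromCorner r w × StartsAtCorner (not r) (reverse w)

  LegPair : Bool → Pred (List (Vertex n) × List (Vertex n)) 0ℓ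
  LegPair r (α , β) = Leg r α × Leg (not r) β × Disjoint α β

  SameLegs : Bool → Pred (List (Vertex n) × List (Vertex n)) 0ℓ
  SameLegs r (α , β) = Leg r α × Leg r β × Disjoint α β

  leg-nonempty : ∀ {r w} → Leg r w → w ≢ [] → FromCorner r w
  leg-nonempty (inj₁ w≡[])      w≢[] = ⊥-elim (w≢[] w≡[])
  leg-nonempty (inj₂ fromCorner) _   = fromCorner

  fromCorner≢[] : ∀ {r w} → FromCorner r w → w ≢ []
  fromCorner≢[] (_ , start) ()

  legs-disjoint : ∀ {r α β} → Leg r α → Leg r β → Disjoint α β → α ≡ [] ⊎ β ≡ []
  legs-disjoint (inj₁ α≡[]) _           _   = inj₁ α≡[]
  legs-disjoint _           (inj₁ β≡[]) _   = inj₂ β≡[]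
  legs-disjoint (inj₂ (_ , start)) (inj₂ (_ , start)) α#β = ⊥-elim (α#β (here refl , here refl))


  shift-injective : ∀ {u v : Vertex n} → shift u ≡ shift v → u ≡ v
  shift-injective refl = refl

  shift-adjacent : ∀ {u v : Vertex n} → Adjacent u v → Adjacent (shift u) (shift v)
  shift-adjacent rung     = rung
  shift-adjacent (rail c) = rail (suc~suc c)

  shift-adjacent⁻ : ∀ {u v : Vertex n} → Adjacent (shift u) (shift v) → Adjacent u v
  shift-adjacent⁻ {_ , _} {_ , _} rung               = rung
  shift-adjacent⁻ {_ , _} {_ , _} (rail (suc~suc c)) = rail c

  shifts-injective : ∀ {γ δ : List (Vertex n)} → shifts γ ≡ shifts δ → γ ≡ δ
  shifts-injective = map-injective shift-injective

  path-shifts : ∀ {γ : List (Vertex n)} → Path Adjacent γ → Path Adjacent (shifts γ)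
  path-shifts = path-map shift-injective shift-adjacent

  path-shifts⁻ : ∀ {γ : List (Vertex n)} → Path Adjacent (shifts γ) → Path Adjacent γ
  path-shifts⁻ = path-map⁻ shift-adjacent⁻

  ∈-shifts⁻ : ∀ {v} {γ : List (Vertex n)} → shift v ∈ shifts γ → v ∈ γ
  ∈-shifts⁻ v∈ with _ , v'∈γ , eq ← ∈-map⁻ shift v∈ =
    subst (_∈ _) (sym (shift-injective eq)) v'∈γ

  corner∉shifts : ∀ {r} (γ : List (Vertex n)) → corner r ∉ shifts γ
  corner∉shifts γ r∈ with _ , _ , () ← ∈-map⁻ shift r∈

  disjoint-shifts : ∀ {γ δ : List (Vertex n)} → Disjoint γ δ → Disjoint (shifts γ) (shifts δ)
  disjoint-shifts γ#δ (v∈γ , v∈δ) with _ , u∈γ , refl ← ∈-map⁻ shift v∈γ =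
    γ#δ (u∈γ , ∈-shifts⁻ v∈δ)

  disjoint-shifts⁻ : ∀ {γ δ : List (Vertex n)} → Disjoint (shifts γ) (shifts δ) → Disjoint γ δ
  disjoint-shifts⁻ γ#δ (v∈γ , v∈δ) = γ#δ (∈-map⁺ shift v∈γ , ∈-map⁺ shift v∈δ)

  shifts-avoiding-corners : ∀ {r} (w : List (Vertex (suc n))) → corner r ∉ w → corner (not r) ∉ w →
                            ∃[ γ ] shifts {n} γ ≡ w
  shifts-avoiding-corners []                _ _ = [] , refl
  shifts-avoiding-corners {r} ((r' , zero) ∷ w) r∉ r̄∉ with r | r'
  ... | false | false = ⊥-elim (r∉ (here refl))
  ... | false | true  = ⊥-elim (r̄∉ (here refl))
  ... | true  | false = ⊥-elim (r̄∉ (here refl))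
  ... | true  | true  = ⊥-elim (r∉ (here refl))
  shifts-avoiding-corners ((r' , suc i) ∷ w) r∉ r̄∉
    with γ , refl ← shifts-avoiding-corners w (r∉ ∘ there) (r̄∉ ∘ there) = (r' , i) ∷ γ , refl


  corner-adjacent-shift : ∀ {r} {v : Vertex n} → Adjacent (corner r) (shift v) → StartsAtCorner r [ v ]
  corner-adjacent-shift (rail 0~1) = start

  corner≢opposite : ∀ {r} → corner {n} r ≢ corner (not r)
  corner≢opposite eq = not-¬ refl (cong proj₁ eq)

  corner∉opposite∷shifts : ∀ {r} (γ : List (Vertex n)) → corner r ∉ corner (not r) ∷ shifts γ
  corner∉opposite∷shifts γ (here x≡x̄) = corner≢opposite x≡x̄
  corner∉opposite∷shifts γ (there x∈) = corner∉shifts γ x∈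

  hang⇔ : ∀ {r} {γ : List (Vertex n)} → Path Adjacent (corner r ∷ shifts γ) ⇔ Leg r γ
  hang⇔ = mk⇔ hang⁻ hang⁺
    where
    hang⁻ : ∀ {r γ} → Path Adjacent (corner r ∷ shifts γ) → Leg r γ
    hang⁻ {γ = []}    _ = inj₁ refl
    hang⁻ {γ = _ ∷ _} p with start ← corner-adjacent-shift (path-step p) =
      inj₂ (path-shifts⁻ (path-tail p) , start)
    hang⁺ : ∀ {r γ} → Leg r γ → Path Adjacent (corner r ∷ shifts γ)
    hang⁺ (inj₁ refl)               = path-[-]
    hang⁺ {γ = γ} (inj₂ (path , start)) = path-∷ (rail 0~1) (corner∉shifts γ) (path-shifts path)

  crossing⇒path : ∀ {r} {γ : List (Vertex n)} → Crossing r γ →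
                  Path Adjacent (corner r ∷ (shifts γ ∷ʳ corner (not r)))
  crossing⇒path {r} {γ@(_ ∷ _)} (fromCorner@(path , _) , ends) =
    path-between (from hang⇔ (inj₂ fromCorner))
      (subst (λ δ → Path Adjacent (corner (not r) ∷ δ)) (reverse-map shift γ)
             (from hang⇔ (inj₂ (path-reverse path , ends))))
      corner≢opposite

  path⇒crossing : ∀ {r} {γ : List (Vertex n)} → γ ≢ [] →
                  Path Adjacent (corner r ∷ (shifts γ ∷ʳ corner (not r))) → Crossing r γ
  path⇒crossing {r} {γ} γ≢[] p =
    leg-nonempty (to hang⇔ (path-++⁻ˡ (corner r ∷ shifts γ) p)) γ≢[] ,
    proj₂ (leg-nonempty (to hang⇔ (subst (λ δ → Path Adjacent (corner (not r) ∷ δ)) (sym (reverse-map shift γ))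
                                         (path-++⁻ˡ (corner (not r) ∷ reverse (shifts γ)) reversed)))
                        (reverse≢[] γ≢[]))
    where
    reversed : Path Adjacent (corner (not r) ∷ (reverse (shifts γ) ∷ʳ corner r))
    reversed = subst (Path Adjacent)
      (trans (reverse-++ (corner r ∷ shifts γ) [ corner (not r) ])
             (cong (corner (not r) ∷_) (unfold-reverse (corner r) (shifts γ))))
      (path-reverse p)

  crossing-shape : ∀ {r} {t : List (Vertex (suc n))} → Path Adjacent (corner r ∷ t) → corner (not r) ∈ t →
                   ¬ StartsAtCorner (not r) t → ∃[ γ ] Crossing r γ × shifts γ ∷ʳ corner (not r) ≡ t
  crossing-shape {r} {t} xt x̄∈t ¬start
    with (α , β) , (x̄α , x̄β , α#β) , glued ← path-split (path-tail xt) x̄∈t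
    with shifts-avoiding-corners α (path-head∉ xt ∘ subst (corner r ∈_) glued ∘ ∈-ʳ++⁺ˡ) (path-head∉ x̄α)
  ... | [] , refl = ⊥-elim (¬start (subst (StartsAtCorner (not r)) glued start))
  ... | α'@(_ ∷ _) , refl
    with β' , refl ← shifts-avoiding-corners β
                       (path-head∉ xt ∘ subst (corner r ∈_) glued ∘ ∈-ʳ++⁺ʳ (shifts α') ∘ there)
                       (path-head∉ x̄β)
    with legs-disjoint (to hang⇔ x̄α) (to hang⇔ x̄β) (disjoint-shifts⁻ α#β)
  ... | inj₂ refl =
    reverse α' ,
    path⇒crossing (reverse≢[] {w = α'} λ ()) (subst (λ t → Path Adjacent (corner r ∷ t)) (sym shape) xt) ,
    shape
    where
    shape : shifts (reverse α') ∷ʳ corner (not r) ≡ t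
    shape = trans (cong (_∷ʳ corner (not r)) (reverse-map shift α')) (trans (sym (ʳ++-defn (shifts α'))) glued)

  startsAtCorner⇒head : ∀ {r} {w : List (Vertex (suc n))} → StartsAtCorner r w → head w ≡ just (corner r)
  startsAtCorner⇒head start = refl

  startsAtCorner⇒∈ : ∀ {r} {w : List (Vertex (suc n))} → StartsAtCorner r w → corner r ∈ w
  startsAtCorner⇒∈ start = here refl

  hang-shape : ∀ {r} {t : List (Vertex (suc n))} → Path Adjacent (corner r ∷ t) → corner (not r) ∉ t →
               ∃[ γ ] Leg r γ × shifts γ ≡ t
  hang-shape {t = t} p x̄∉t with γ , refl ← shifts-avoiding-corners t (path-head∉ p) x̄∉t =
    γ , to hang⇔ p , refl

  visit-opposite-corner : ∀ {r} {t : List (Vertex (suc n))} → Path Adjacent (corner r ∷ t) → corner (not r) ∈ t →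
                          (∃[ β ] Leg (not r) β × corner (not r) ∷ shifts β ≡ t) ⊎
                          (∃[ γ ] Crossing r γ × shifts γ ∷ʳ corner (not r) ≡ t)
  visit-opposite-corner {r} {v ∷ t} p x̄∈t with v ≟ᵥ corner (not r)
  ... | yes refl
    with β , refl ← shifts-avoiding-corners t (path-head∉ p ∘ there) (path-head∉ (path-tail p)) =
    inj₁ (β , to hang⇔ (path-tail p) , refl)
  ... | no v≢x̄ = inj₂ (crossing-shape p x̄∈t (v≢x̄ ∘ just-injective ∘ startsAtCorner⇒head))

-- Counting paths in the ladder

module _ {n : ℕ} where

  count-legs : ∀ {r s} → Count (FromCorner {n} r) s → Count (Leg r) (1 + s)
  count-legs c = count-∪ (count-≡ []) c λ { _ (refl , _ , ()) }

count-crossings : ∀ n r → Count (Crossing {n} r) n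
count-crossings zero    r = count-empty λ { _ ((_ , ()) , _) }
count-crossings (suc n) r =
  count-resp (sound , complete)
    (count-∪ (count-≡ (x ∷ x̄ ∷ []))
             (count-image extend (λ _ _ → shifts-injective ∘ ∷ʳ-injectiveˡ _ _ ∘ ∷-injectiveʳ) (count-crossings n r))
             disjoint)
  where
  x x̄ : Vertex (suc n)
  x = corner r
  x̄ = corner (not r)
  extend : List (Vertex n) → List (Vertex (suc n))
  extend γ = x ∷ (shifts γ ∷ʳ x̄)
  Extended : Pred (List (Vertex (suc n))) 0ℓ
  Extended = Image extend (Crossing r)
  disjoint : Empty ((_≡ x ∷ x̄ ∷ []) ∩ Extended)
  disjoint _ (refl , [] , ((_ , ()) , _) , _)
  disjoint _ (refl , _ ∷ _ , _ , ())
  sound : (_≡ x ∷ x̄ ∷ []) ∪ Extended ⊆ Crossing r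
  sound (inj₁ refl)            = (path-∷ rung (corner∉opposite∷shifts []) path-[-] , start) , start
  sound (inj₂ (γ , c , refl)) =
    (crossing⇒path c , start) , subst (StartsAtCorner (not r)) (sym (reverse-++ (x ∷ shifts γ) [ x̄ ])) start
  complete : Crossing r ⊆ (_≡ x ∷ x̄ ∷ []) ∪ Extended
  complete {.x ∷ t} ((p , start) , ends) with visit-opposite-corner p x̄∈t
    where
    x̄∈t : x̄ ∈ t
    x̄∈t with Any.reverse⁻ {xs = x ∷ t} (startsAtCorner⇒∈ ends)
    ... | here x̄≡x  = ⊥-elim (corner≢opposite (sym x̄≡x))
    ... | there x̄∈t = x̄∈t
  ... | inj₁ ([] , _ , refl)     = inj₁ refl
  -- The crossing ends at x̄, so nothing can follow x̄.
  ... | inj₁ (b ∷ β , _ , refl) with y , eq , y∈ ← head-ʳ++ (shift b) (shifts β) (x̄ ∷ x ∷ []) =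
    ⊥-elim (corner∉shifts (b ∷ β)
              (subst (_∈ shifts (b ∷ β)) (just-injective (trans (sym eq) (startsAtCorner⇒head ends))) y∈))
  ... | inj₂ (γ , c , refl)      = inj₂ (γ , c , refl)

module _ {n : ℕ} {r : Bool} where

  open DecMembership (_≟ᵥ_ {suc n}) using (_∈?_)

  private
    x x̄ : Vertex (suc n)
    x = corner r
    x̄ = corner (not r)

  count-fromCorner-suc : ∀ {a b c} →
                         Count (Leg {n} r) a → Count (Leg {n} (not r)) b → Count (Crossing {n} r) c →
                         Count (FromCorner {suc n} r) (a + (b + c))
  count-fromCorner-suc cLeg cOppositeLeg cCrossing =
    count-resp (sound , complete)
      (count-∪ (count-image (λ γ → x ∷ shifts γ) (λ _ _ → shifts-injective ∘ ∷-injectiveʳ) cLeg)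
               (count-∪ (count-image (λ β → x ∷ x̄ ∷ shifts β)
                                     (λ _ _ → shifts-injective ∘ ∷-injectiveʳ ∘ ∷-injectiveʳ) cOppositeLeg)
                        (count-image (λ γ → x ∷ (shifts γ ∷ʳ x̄))
                                     (λ _ _ → shifts-injective ∘ ∷ʳ-injectiveˡ _ _ ∘ ∷-injectiveʳ) cCrossing)
                        rung-first-or-last)
               avoids-or-visits)
    where
    Hanging Rung Returning : Pred (List (Vertex (suc n))) 0ℓ
    Hanging = Image (λ γ → x ∷ shifts γ) (Leg r)
    Rung = Image (λ β → x ∷ x̄ ∷ shifts β) (Leg (not r))
    Returning = Image (λ γ → x ∷ (shifts γ ∷ʳ x̄)) (Crossing r)
    avoids-or-visits : Empty (Hanging ∩ (Rung ∪ Returning))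
    avoids-or-visits _ ((γ , _ , refl) , inj₁ (β , _ , eq)) =
      corner∉shifts γ (subst (x̄ ∈_) (∷-injectiveʳ eq) (here refl))
    avoids-or-visits _ ((γ , _ , refl) , inj₂ (δ , _ , eq)) =
      corner∉shifts γ (subst (x̄ ∈_) (∷-injectiveʳ eq) (∈-++⁺ʳ (shifts δ) (here refl)))
    rung-first-or-last : Empty (Rung ∩ Returning)
    rung-first-or-last _ ((β , _ , refl) , [] , ((_ , ()) , _) , _)
    rung-first-or-last _ ((β , _ , refl) , _ ∷ _ , _ , ())
    sound : Hanging ∪ (Rung ∪ Returning) ⊆ FromCorner r
    sound (inj₁ (γ , leg , refl))         = from hang⇔ leg , start
    sound (inj₂ (inj₁ (β , leg , refl))) = path-∷ rung (corner∉opposite∷shifts β) (from hang⇔ leg) , start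
    sound (inj₂ (inj₂ (γ , c , refl)))    = crossing⇒path c , start
    complete : FromCorner r ⊆ Hanging ∪ (Rung ∪ Returning)
    complete {.x ∷ t} (p , start) with x̄ ∈? t
    ... | no x̄∉t = let γ , leg , eq = hang-shape p x̄∉t in inj₁ (γ , leg , cong (x ∷_) eq)
    ... | yes x̄∈t with visit-opposite-corner p x̄∈t
    ...   | inj₁ (β , leg , eq) = inj₂ (inj₁ (β , leg , cong (x ∷_) eq))
    ...   | inj₂ (γ , c , eq)   = inj₂ (inj₂ (γ , c , cong (x ∷_) eq))

  count-legPairs-suc : ∀ {a b c} →
                       Count (Leg {suc n} (not r)) a → Count (FromCorner {suc n} r) b → Count (LegPair {n} r) c →
                       Count (LegPair {suc n} r) (a + (b + c))
  count-legPairs-suc cOppositeLeg cFromCorner cLegPair =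
    count-resp (sound , complete)
      (count-∪ (count-image ([] ,_) (λ _ _ → cong proj₂) cOppositeLeg)
               (count-∪ (count-image (_, []) (λ _ _ → cong proj₁) cFromCorner)
                        (count-image extend (λ _ _ → extend-injective) cLegPair)
                        (λ { _ ((_ , _ , refl) , (_ , _ , ())) }))
               λ { _ ((_ , _ , refl) , inj₁ (_ , (_ , ()) , refl)) ; _ ((_ , _ , refl) , inj₂ (_ , _ , ())) })
    where
    extend : List (Vertex n) × List (Vertex n) → List (Vertex (suc n)) × List (Vertex (suc n))
    extend (α , β) = x ∷ shifts α , x̄ ∷ shifts β
    extend-injective : ∀ {p q} → extend p ≡ extend q → p ≡ q
    extend-injective eq =
      cong₂ _,_ (shifts-injective (∷-injectiveʳ (cong proj₁ eq))) (shifts-injective (∷-injectiveʳ (cong proj₂ eq)))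
    Decomposed : Pred (List (Vertex (suc n)) × List (Vertex (suc n))) 0ℓ
    Decomposed = Image ([] ,_) (Leg (not r)) ∪ (Image (_, []) (FromCorner r) ∪ Image extend (LegPair r))
    sound : Decomposed ⊆ LegPair r
    sound (inj₁ (β , leg , refl))        = inj₁ refl , leg , λ ()
    sound (inj₂ (inj₁ (α , fc , refl)))  = inj₂ fc , inj₁ refl , λ ()
    sound (inj₂ (inj₂ ((α , β) , (legα , legβ , α#β) , refl))) =
      inj₂ (from hang⇔ legα , start) , inj₂ (from hang⇔ legβ , start) , extended-disjoint
      where
      extended-disjoint : Disjoint (x ∷ shifts α) (x̄ ∷ shifts β)
      extended-disjoint (here refl , v∈)      = corner∉opposite∷shifts β v∈
      extended-disjoint (there v∈ , here refl) = corner∉shifts α v∈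
      extended-disjoint (there v∈ , there v∈') = disjoint-shifts α#β (v∈ , v∈')
    complete : LegPair r ⊆ Decomposed
    complete {[] , β}       (inj₁ refl , legβ , _)       = inj₁ (β , legβ , refl)
    complete {α , []}       (inj₂ fc , inj₁ refl , _)    = inj₂ (inj₁ (α , fc , refl))
    complete {.x ∷ t , .x̄ ∷ u} (inj₂ (pα , start) , inj₂ (pβ , start) , α#β)
      with α' , refl ← shifts-avoiding-corners t (path-head∉ pα) (λ x̄∈t → α#β (there x̄∈t , here refl))
      with β' , refl ← shifts-avoiding-corners u (λ x∈u → α#β (here refl , there x∈u)) (path-head∉ pβ) =
      inj₂ (inj₂ ((α' , β') , (to hang⇔ pα , to hang⇔ pβ , disjoint-shifts⁻ (contractₗ (contractᵣ α#β))) ,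
                  refl))

  count-sameLegs : ∀ {a b} → Count (Leg {n} r) a → Count (FromCorner {n} r) b → Count (SameLegs r) (a + b)
  count-sameLegs cLeg cFromCorner =
    count-resp (sound , complete)
      (count-∪ (count-image ([] ,_) (λ _ _ → cong proj₂) cLeg)
               (count-image (_, []) (λ _ _ → cong proj₁) cFromCorner)
               λ { _ ((_ , _ , refl) , (_ , (_ , ()) , refl)) })
    where
    sound : Image ([] ,_) (Leg r) ∪ Image (_, []) (FromCorner r) ⊆ SameLegs r
    sound (inj₁ (β , leg , refl)) = inj₁ refl , leg , λ ()
    sound (inj₂ (α , fc , refl))  = inj₂ fc , inj₁ refl , λ ()
    complete : SameLegs r ⊆ Image ([] ,_) (Leg r) ∪ Image (_, []) (FromCorner r)
    complete {α , β} (legα , legβ , α#β) with legs-disjoint legα legβ α#β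
    ... | inj₁ refl = inj₁ (β , legβ , refl)
    ... | inj₂ refl with α | legα
    ...   | [] | _         = inj₁ ([] , inj₁ refl , refl)
    ...   | _ ∷ _ | legα'  = inj₂ (_ , leg-nonempty legα' (λ ()) , refl)

  count-through-corner : ∀ {j} → Count (SameLegs {n} r) j →
                         Count (λ w → Path Adjacent w × x ∈ w × x̄ ∉ w) j
  count-through-corner cSameLegs =
    count-paths-through (count-bijection shifts² (λ _ _ → shifts²-injective) cSameLegs sound complete)
    where
    shifts² : List (Vertex n) × List (Vertex n) → List (Vertex (suc n)) × List (Vertex (suc n))
    shifts² (α , β) = shifts α , shifts β
    shifts²-injective : ∀ {p q} → shifts² p ≡ shifts² q → p ≡ q
    shifts²-injective eq = cong₂ _,_ (shifts-injective (cong proj₁ eq)) (shifts-injective (cong proj₂ eq))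
    sound : ∀ {p} → SameLegs r p → Fork x (shifts² p) × x̄ ∉ glue x (shifts² p)
    sound {α , β} (legα , legβ , α#β) =
      (from hang⇔ legα , from hang⇔ legβ , disjoint-shifts α#β) , x̄∉
      where
      x̄∉ : x̄ ∉ glue x (shifts α , shifts β)
      x̄∉ x̄∈ with ∈-ʳ++⁻ (shifts α) x̄∈
      ... | inj₁ x̄∈α         = corner∉shifts α x̄∈α
      ... | inj₂ (here x̄≡x)  = corner≢opposite (sym x̄≡x)
      ... | inj₂ (there x̄∈β) = corner∉shifts β x̄∈β
    complete : ∀ {p} → Fork x p × x̄ ∉ glue x p → ∃[ q ] SameLegs r q × shifts² q ≡ p
    complete {α , β} ((xα , xβ , α#β) , x̄∉)
      with α' , refl ← shifts-avoiding-corners α (path-head∉ xα) (x̄∉ ∘ ∈-ʳ++⁺ˡ)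
      with β' , refl ← shifts-avoiding-corners β (path-head∉ xβ) (x̄∉ ∘ ∈-ʳ++⁺ʳ (shifts α') ∘ there)
      =
      (α' , β') , (to hang⇔ xα , to hang⇔ xβ , disjoint-shifts⁻ α#β) , refl

  count-forks-visiting-opposite : ∀ {p q} → Count (LegPair {n} r) p → Count (Crossing {n} r) q →
                                  Count (λ (α , β) → Fork x (α , β) × x̄ ∈ α) (p + q)
  count-forks-visiting-opposite cLegPair cCrossing =
    count-resp (sound , complete)
      (count-∪ (count-image rungFirst (λ _ _ → rungFirst-injective) cLegPair)
               (count-image returning (λ _ _ → shifts-injective ∘ ∷ʳ-injectiveˡ _ _ ∘ cong proj₁) cCrossing)
               λ { _ ((_ , _ , refl) , ([] , ((_ , ()) , _) , _)) ; _ ((_ , _ , refl) , (_ ∷ _ , _ , ())) })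
    where
    rungFirst : List (Vertex n) × List (Vertex n) → List (Vertex (suc n)) × List (Vertex (suc n))
    rungFirst (α , β) = x̄ ∷ shifts β , shifts α
    rungFirst-injective : ∀ {p q} → rungFirst p ≡ rungFirst q → p ≡ q
    rungFirst-injective eq =
      cong₂ _,_ (shifts-injective (cong proj₂ eq)) (shifts-injective (∷-injectiveʳ (cong proj₁ eq)))
    returning : List (Vertex n) → List (Vertex (suc n)) × List (Vertex (suc n))
    returning γ = shifts γ ∷ʳ x̄ , []
    Visiting : Pred (List (Vertex (suc n)) × List (Vertex (suc n))) 0ℓ
    Visiting (α , β) = Fork x (α , β) × x̄ ∈ α
    sound : Image rungFirst (LegPair r) ∪ Image returning (Crossing r) ⊆ Visiting
    sound (inj₁ ((α , β) , (legα , legβ , α#β) , refl)) =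
      (path-∷ rung (corner∉opposite∷shifts β) (from hang⇔ legβ) , from hang⇔ legα , β#α) , here refl
      where
      β#α : Disjoint (x̄ ∷ shifts β) (shifts α)
      β#α (here refl , x̄∈α) = corner∉shifts α x̄∈α
      β#α (there v∈β , v∈α) = disjoint-shifts α#β (v∈α , v∈β)
    sound (inj₂ (γ , c , refl)) = (crossing⇒path c , path-[-] , λ ()) , ∈-++⁺ʳ (shifts γ) (here refl)
    complete : Visiting ⊆ Image rungFirst (LegPair r) ∪ Image returning (Crossing r)
    complete {α , β} ((xα , xβ , α#β) , x̄∈α) with visit-opposite-corner xα x̄∈α
    ... | inj₁ (β' , legβ' , refl)
      with α' , legα' , refl ← hang-shape xβ (λ x̄∈β → α#β (here refl , x̄∈β)) =
      inj₁ ((α' , β') , (legα' , legβ' , disjoint-shifts⁻ (Disjoint.sym (contractₗ α#β))) , refl)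
    ... | inj₂ (γ , c , refl)
      with δ , legδ , refl ← hang-shape xβ (λ x̄∈β → α#β (x̄∈α , x̄∈β))
      with legs-disjoint (inj₂ (proj₁ c)) legδ (disjoint-shifts⁻ (α#β ∘ map₁ ∈-++⁺ˡ))
    ...   | inj₁ refl = ⊥-elim (fromCorner≢[] (proj₁ c) refl)
    ...   | inj₂ refl = inj₂ (γ , c , refl)

  count-through-both-corners : ∀ {p q} → Count (LegPair {n} r) p → Count (Crossing {n} r) q →
                               Count (λ w → Path Adjacent w × x ∈ w × x̄ ∈ w) ((p + q) + (p + q))
  count-through-both-corners cLegPair cCrossing =
    count-paths-through (count-resp (merge , split)
      (count-∪ cFirst
               (count-bijection swap (λ _ _ → cong swap) cFirst (map₁ fork-swap)
                                λ { {α , β} (fork , x̄∈β) → (β , α) , (fork-swap fork , x̄∈β) , refl })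
               λ _ (((_ , _ , α#β) , x̄∈α) , (_ , x̄∈β)) → α#β (x̄∈α , x̄∈β)))
    where
    cFirst = count-forks-visiting-opposite cLegPair cCrossing
    merge : ∀ {p} → (Fork x p × x̄ ∈ proj₁ p) ⊎ (Fork x p × x̄ ∈ proj₂ p) →
            Fork x p × x̄ ∈ glue x p
    merge {α , β} (inj₁ (fork , x̄∈α)) = fork , ∈-ʳ++⁺ˡ x̄∈α
    merge {α , β} (inj₂ (fork , x̄∈β)) = fork , ∈-ʳ++⁺ʳ α (there x̄∈β)
    split : ∀ {p} → Fork x p × x̄ ∈ glue x p →
            (Fork x p × x̄ ∈ proj₁ p) ⊎ (Fork x p × x̄ ∈ proj₂ p)
    split {α , β} (fork , x̄∈) with ∈-ʳ++⁻ α x̄∈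
    ... | inj₁ x̄∈α         = inj₁ (fork , x̄∈α)
    ... | inj₂ (here x̄≡x)  = ⊥-elim (corner≢opposite (sym x̄≡x))
    ... | inj₂ (there x̄∈β) = inj₂ (fork , x̄∈β)

module _ {n : ℕ} where

  open DecMembership (_≟ᵥ_ {suc n}) using (_∈?_)

  private
    X Y : Vertex (suc n)
    X = corner false
    Y = corner true

  count-paths-suc : ∀ {a b c p q} →
                    Count (Path {Vertex n} Adjacent) a → Count (SameLegs {n} false) b → Count (SameLegs {n} true) c →
                    Count (LegPair {n} false) p → Count (Crossing {n} false) q →
                    Count (Path {Vertex (suc n)} Adjacent) (a + (b + (c + ((p + q) + (p + q)))))
  count-paths-suc cPaths cSameX cSameY cLegPair cCrossing =
    count-resp (sound , complete)
      (count-∪ (count-image shifts (λ _ _ → shifts-injective) cPaths)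
               (count-∪ (count-through-corner cSameX)
                        (count-∪ (count-through-corner cSameY) (count-through-both-corners cLegPair cCrossing)
                                 λ _ ((_ , _ , X∉) , (_ , X∈ , _)) → X∉ X∈)
                        λ { _ ((_ , _ , Y∉) , inj₁ (_ , Y∈ , _)) → Y∉ Y∈
                          ; _ ((_ , _ , Y∉) , inj₂ (_ , _ , Y∈)) → Y∉ Y∈ })
               λ { _ ((γ , _ , refl) , inj₁ (_ , X∈ , _))         → corner∉shifts γ X∈
                 ; _ ((γ , _ , refl) , inj₂ (inj₁ (_ , Y∈ , _)))  → corner∉shifts γ Y∈
                 ; _ ((γ , _ , refl) , inj₂ (inj₂ (_ , X∈ , _)))  → corner∉shifts γ X∈ })
    where
    Through : Vertex (suc n) → Vertex (suc n) → Pred (List (Vertex (suc n))) 0ℓ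
    Through v v̄ w = Path Adjacent w × v ∈ w × v̄ ∉ w
    Classified : Pred (List (Vertex (suc n))) 0ℓ
    Classified =
      Image shifts (Path Adjacent) ∪ (Through X Y ∪ (Through Y X ∪ (λ w → Path Adjacent w × X ∈ w × Y ∈ w)))
    sound : Classified ⊆ Path Adjacent
    sound (inj₁ (γ , path , refl))        = path-shifts path
    sound (inj₂ (inj₁ (path , _)))         = path
    sound (inj₂ (inj₂ (inj₁ (path , _))))  = path
    sound (inj₂ (inj₂ (inj₂ (path , _))))  = path
    complete : Path Adjacent ⊆ Classified
    complete {w} path with X ∈? w | Y ∈? w
    ... | yes X∈ | yes Y∈ = inj₂ (inj₂ (inj₂ (path , X∈ , Y∈)))
    ... | yes X∈ | no Y∉  = inj₂ (inj₁ (path , X∈ , Y∉))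
    ... | no X∉  | yes Y∈ = inj₂ (inj₂ (inj₁ (path , Y∈ , X∉)))
    ... | no X∉  | no Y∉ with γ , refl ← shifts-avoiding-corners w X∉ Y∉ =
      inj₁ (γ , path-shifts⁻ path , refl)

#fromCorner : ℕ → ℕ
#fromCorner zero    = 0
#fromCorner (suc n) = (1 + #fromCorner n) + ((1 + #fromCorner n) + n)

#legPairs : ℕ → ℕ
#legPairs zero    = 1
#legPairs (suc n) = (1 + #fromCorner (suc n)) + (#fromCorner (suc n) + #legPairs n)

#paths : ℕ → ℕ
#paths zero    = 1
#paths (suc n) = #paths n + (#sameLegs + (#sameLegs + ((#legPairs n + n) + (#legPairs n + n))))
  where
  #sameLegs = (1 + #fromCorner n) + #fromCorner n

count-fromCorner : ∀ n r → Count (FromCorner {n} r) (#fromCorner n)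
count-fromCorner zero    r = count-empty λ { _ (_ , ()) }
count-fromCorner (suc n) r =
  count-fromCorner-suc (count-legs (count-fromCorner n r)) (count-legs (count-fromCorner n (not r)))
                       (count-crossings n r)

count-legPairs : ∀ n r → Count (LegPair {n} r) (#legPairs n)
count-legPairs zero    r =
  count-resp ((λ { refl → inj₁ refl , inj₁ refl , λ () }) , only-empty) (count-≡ ([] , []))
  where
  only-empty : ∀ {p} → LegPair {0} r p → p ≡ ([] , [])
  only-empty (inj₁ refl , inj₁ refl , _) = refl
  only-empty (inj₂ (_ , ()) , _)
  only-empty (_ , inj₂ (_ , ()) , _)
count-legPairs (suc n) r =
  count-legPairs-suc (count-legs (count-fromCorner (suc n) (not r))) (count-fromCorner (suc n) r)
                     (count-legPairs n r)

count-paths : ∀ n → Count (Path {Vertex n} Adjacent) (#paths n)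
count-paths zero    = count-resp ((λ { refl → path-[] }) , only-empty) (count-≡ [])
  where
  only-empty : ∀ {w} → Path {Vertex 0} Adjacent w → w ≡ []
  only-empty {[]}            _ = refl
  only-empty {(_ , ()) ∷ _}  _
count-paths (suc n) =
  count-paths-suc (count-paths n) (sameLegs false) (sameLegs true)
                  (count-legPairs n false) (count-crossings n false)
  where
  sameLegs : ∀ r → Count (SameLegs {n} r) ((1 + #fromCorner n) + #fromCorner n)
  sameLegs r = count-sameLegs (count-legs (count-fromCorner n r)) (count-fromCorner n r)

open ≡-Reasoning

fromCorner-closed : ∀ n → #fromCorner n + n + 3 ≡ 3 * 2 ^ n
fromCorner-closed zero    = refl
fromCorner-closed (suc n) = begin
  #fromCorner (suc n) + suc n + 3  ≡⟨ step (#fromCorner n) n ⟩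
  2 * (#fromCorner n + n + 3)      ≡⟨ cong (2 *_) (fromCorner-closed n) ⟩
  2 * (3 * 2 ^ n)                  ≡⟨ double (2 ^ n) ⟩
  3 * 2 ^ suc n                    ∎
  where
  step : ∀ s n → (1 + s) + ((1 + s) + n) + suc n + 3 ≡ 2 * (s + n + 3)
  step = solve-∀
  double : ∀ t → 2 * (3 * t) ≡ 3 * (2 * t)
  double = solve-∀

legPairs-closed : ∀ n → #legPairs n + n ^ 2 + 6 * n + 11 ≡ 12 * 2 ^ n
legPairs-closed zero    = refl
legPairs-closed (suc n) = begin
  #legPairs (suc n) + suc n ^ 2 + 6 * suc n + 11
    ≡⟨ step (#fromCorner (suc n)) (#legPairs n) n ⟩
  2 * (#fromCorner (suc n) + suc n + 3) + (#legPairs n + n ^ 2 + 6 * n + 11)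
    ≡⟨ cong₂ (λ a b → 2 * a + b) (fromCorner-closed (suc n)) (legPairs-closed n) ⟩
  2 * (3 * 2 ^ suc n) + 12 * 2 ^ n
    ≡⟨ double (2 ^ n) ⟩
  12 * 2 ^ suc n ∎
  where
  -- The ring solver does not support _^_, so powers are written unfolded, as n * (n * 1).
  step : ∀ s p n → (1 + s) + (s + p) + suc n * (suc n * 1) + 6 * suc n + 11
                 ≡ 2 * (s + suc n + 3) + (p + n * (n * 1) + 6 * n + 11)
  step = solve-∀
  double : ∀ t → 2 * (3 * (2 * t)) + 12 * t ≡ 12 * (2 * t)
  double = solve-∀

paths-closed : ∀ n → 3 * #paths n + 2 * n ^ 3 + 18 * n ^ 2 + 76 * n + 105 ≡ 108 * 2 ^ n
paths-closed zero    = refl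
paths-closed (suc n) = begin
  3 * #paths (suc n) + 2 * suc n ^ 3 + 18 * suc n ^ 2 + 76 * suc n + 105
    ≡⟨ step (#paths n) (#fromCorner n) (#legPairs n) n ⟩
  (3 * #paths n + 2 * n ^ 3 + 18 * n ^ 2 + 76 * n + 105)
    + 12 * (#fromCorner n + n + 3) + 6 * (#legPairs n + n ^ 2 + 6 * n + 11)
    ≡⟨ cong₂ (λ a b → a + 12 * b + 6 * (#legPairs n + n ^ 2 + 6 * n + 11)) (paths-closed n) (fromCorner-closed n) ⟩
  108 * 2 ^ n + 12 * (3 * 2 ^ n) + 6 * (#legPairs n + n ^ 2 + 6 * n + 11)
    ≡⟨ cong (λ b → 108 * 2 ^ n + 12 * (3 * 2 ^ n) + 6 * b) (legPairs-closed n) ⟩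
  108 * 2 ^ n + 12 * (3 * 2 ^ n) + 6 * (12 * 2 ^ n)
    ≡⟨ double (2 ^ n) ⟩
  108 * 2 ^ suc n ∎
  where
  step : ∀ w s p n →
    3 * (w + (((1 + s) + s) + (((1 + s) + s) + ((p + n) + (p + n))))) + 2 * (suc n * (suc n * (suc n * 1)))
      + 18 * (suc n * (suc n * 1)) + 76 * suc n + 105
    ≡ (3 * w + 2 * (n * (n * (n * 1))) + 18 * (n * (n * 1)) + 76 * n + 105)
      + 12 * (s + n + 3) + 6 * (p + n * (n * 1) + 6 * n + 11)
  step = solve-∀
  double : ∀ t → 108 * t + 12 * (3 * t) + 6 * (12 * t) ≡ 108 * (2 * t)
  double = solve-∀

-- The ladder of the statement

module _ {m n : ℕ} (G : Graph m) (H : Graph n) where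

  ProductAdj : Fin m × Fin n → Fin m × Fin n → Set
  ProductAdj (x , y) (x' , y') = (Adj G x x' × y ≡ y') ⊎ (x ≡ x' × Adj H y y')

  □-adj⇔ : ∀ u v → Adj (G □ H) u v ⇔ ProductAdj (remQuot {m} n u) (remQuot {m} n v)
  □-adj⇔ u v with remQuot {m} n u | remQuot {m} n v
  ... | _ | _ = mk⇔ id id

  □-adj-combine⇔ : ∀ x y x' y' → Adj (G □ H) (combine x y) (combine x' y') ⇔ ProductAdj (x , y) (x' , y')
  □-adj-combine⇔ x y x' y' =
    subst₂ (λ p q → Adj (G □ H) (combine x y) (combine x' y') ⇔ ProductAdj p q)
           (remQuot-combine x y) (remQuot-combine x' y') (□-adj⇔ (combine x y) (combine x' y'))

  □-sym : Symmetric (Adj G) → Symmetric (Adj H) → Symmetric (Adj (G □ H))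
  □-sym G-sym H-sym {u} {v} a = from (□-adj⇔ v u) (product-sym (to (□-adj⇔ u v) a))
    where
    product-sym : ∀ {p q} → ProductAdj p q → ProductAdj q p
    product-sym (inj₁ (a , eq)) = inj₁ (G-sym a , sym eq)
    product-sym (inj₂ (eq , a)) = inj₂ (sym eq , H-sym a)

pathGraph-sym : ∀ {n} → Symmetric (Adj (PathGraph n))
pathGraph-sym = Sum.swap

consecutive⇔ : ∀ {n} (i j : Fin n) → Consecutive i j ⇔ Adj (PathGraph n) i j
consecutive⇔ i j = mk⇔ (consecutive⇒adj) (adj⇒consecutive i j)
  where
  consecutive⇒adj : ∀ {n} {i j : Fin n} → Consecutive i j → Adj (PathGraph n) i j
  consecutive⇒adj 0~1         = inj₁ refl
  consecutive⇒adj 1~0         = inj₂ refl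
  consecutive⇒adj (suc~suc c) with consecutive⇒adj c
  ... | inj₁ eq = inj₁ (cong suc eq)
  ... | inj₂ eq = inj₂ (cong suc eq)
  adj⇒consecutive : ∀ {n} (i j : Fin n) → Adj (PathGraph n) i j → Consecutive i j
  adj⇒consecutive zero          (suc zero)    _         = 0~1
  adj⇒consecutive (suc zero)    zero          _         = 1~0
  adj⇒consecutive (suc i)       (suc j)       (inj₁ eq) = suc~suc (adj⇒consecutive i j (inj₁ (suc-injective eq)))
  adj⇒consecutive (suc i)       (suc j)       (inj₂ eq) = suc~suc (adj⇒consecutive i j (inj₂ (suc-injective eq)))
  adj⇒consecutive zero          zero          (inj₁ ())
  adj⇒consecutive zero          zero          (inj₂ ())
  adj⇒consecutive zero          (suc (suc _)) (inj₁ ())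
  adj⇒consecutive zero          (suc (suc _)) (inj₂ ())
  adj⇒consecutive (suc (suc _)) zero          (inj₁ ())
  adj⇒consecutive (suc (suc _)) zero          (inj₂ ())

row : Bool → Fin 2
row false = zero
row true  = suc zero

row⁻¹ : Fin 2 → Bool
row⁻¹ zero       = false
row⁻¹ (suc zero) = true

rung-rows : ∀ r r' → Adj (PathGraph 2) (row r) (row r') → r' ≡ not r
rung-rows false true  _ = refl
rung-rows true  false _ = refl
rung-rows false false (inj₁ ())
rung-rows false false (inj₂ ())
rung-rows true  true  (inj₁ ())
rung-rows true  true  (inj₂ ())

row-injective : ∀ r r' → row r ≡ row r' → r ≡ r'
row-injective false false _ = refl
row-injective true  true  _ = refl

module _ {k : ℕ} where

  ladder-vertex : Vertex (suc k) → Fin (2 * suc k)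
  ladder-vertex (r , i) = combine (row r) i

  ladder-vertex⁻¹ : Fin (2 * suc k) → Vertex (suc k)
  ladder-vertex⁻¹ u = row⁻¹ (proj₁ (remQuot {2} (suc k) u)) , proj₂ (remQuot {2} (suc k) u)

  ladder-vertex⁻¹-inverseˡ : ∀ v → ladder-vertex⁻¹ (ladder-vertex v) ≡ v
  ladder-vertex⁻¹-inverseˡ (r , i) =
    trans (cong (λ p → row⁻¹ (proj₁ p) , proj₂ p) (remQuot-combine {2} {suc k} (row r) i))
          (cong (_, i) (row⁻¹-row r))
    where
    row⁻¹-row : ∀ r → row⁻¹ (row r) ≡ r
    row⁻¹-row false = refl
    row⁻¹-row true  = refl

  ladder-vertex⁻¹-inverseʳ : ∀ u → ladder-vertex (ladder-vertex⁻¹ u) ≡ u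
  ladder-vertex⁻¹-inverseʳ u =
    trans (cong (λ a → combine a (proj₂ (remQuot {2} (suc k) u)))
                (row-row⁻¹ (proj₁ (remQuot {2} (suc k) u))))
          (combine-remQuot {2} (suc k) u)
    where
    row-row⁻¹ : ∀ a → row (row⁻¹ a) ≡ a
    row-row⁻¹ zero       = refl
    row-row⁻¹ (suc zero) = refl

  adjacent⇔ladder : ∀ {v w : Vertex (suc k)} →
                    Adjacent v w ⇔ Adj (Ladder k) (ladder-vertex v) (ladder-vertex w)
  adjacent⇔ladder {r , i} {r' , j} =
    mk⇔ (from (□-adj-combine⇔ (PathGraph 2) (PathGraph (suc k)) (row r) i (row r') j) ∘ product)
        (model ∘ to (□-adj-combine⇔ (PathGraph 2) (PathGraph (suc k)) (row r) i (row r') j))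
    where
    product : Adjacent (r , i) (r' , j) → ProductAdj (PathGraph 2) (PathGraph (suc k)) (row r , i) (row r' , j)
    product (rung {false}) = inj₁ (inj₁ refl , refl)
    product (rung {true})  = inj₁ (inj₂ refl , refl)
    product (rail c)       = inj₂ (refl , to (consecutive⇔ i j) c)
    model : ProductAdj (PathGraph 2) (PathGraph (suc k)) (row r , i) (row r' , j) → Adjacent (r , i) (r' , j)
    model (inj₁ (a , refl)) with refl ← rung-rows r r' a = rung
    model (inj₂ (eq , a))   with refl ← row-injective r r' eq = rail (from (consecutive⇔ i j) a)

ladder-paths : ∀ k → Count (Path (Adj (Ladder k))) (#paths (suc k))
ladder-paths k =
  count-paths-transfer ladder-vertex ladder-vertex⁻¹ ladder-vertex⁻¹-inverseˡ ladder-vertex⁻¹-inverseʳ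
                       adjacent⇔ladder (count-paths (suc k))

ladder-sym : ∀ k → Symmetric (Adj (Ladder k))
ladder-sym k {u} {v} = □-sym (PathGraph 2) (PathGraph (suc k)) pathGraph-sym pathGraph-sym {u} {v}

pn-closed-form : ∀ k c → #paths (suc k) + 2 * suc k ≡ 1 + 2 * c →
                 3 * c + k ^ 3 + 12 * k ^ 2 + 56 * k + 99 ≡ 108 * 2 ^ k
pn-closed-form k c paths≡ = *-cancelˡ-≡ _ _ 2 (begin
  2 * (3 * c + k ^ 3 + 12 * k ^ 2 + 56 * k + 99)
    ≡⟨ regroup c k ⟩
  3 * (1 + 2 * c) + 2 * k ^ 3 + 24 * k ^ 2 + 112 * k + 195
    ≡⟨ cong (λ m → 3 * m + 2 * k ^ 3 + 24 * k ^ 2 + 112 * k + 195) (sym paths≡) ⟩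
  3 * (#paths (suc k) + 2 * suc k) + 2 * k ^ 3 + 24 * k ^ 2 + 112 * k + 195
    ≡⟨ shift-index (#paths (suc k)) k ⟩
  3 * #paths (suc k) + 2 * suc k ^ 3 + 18 * suc k ^ 2 + 76 * suc k + 105
    ≡⟨ paths-closed (suc k) ⟩
  108 * 2 ^ suc k
    ≡⟨ double (2 ^ k) ⟩
  2 * (108 * 2 ^ k) ∎)
  where
  regroup : ∀ c k → 2 * (3 * c + k * (k * (k * 1)) + 12 * (k * (k * 1)) + 56 * k + 99)
                  ≡ 3 * (1 + 2 * c) + 2 * (k * (k * (k * 1))) + 24 * (k * (k * 1)) + 112 * k + 195
  regroup = solve-∀
  shift-index : ∀ w k → 3 * (w + 2 * suc k) + 2 * (k * (k * (k * 1))) + 24 * (k * (k * 1)) + 112 * k + 195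
                      ≡ 3 * w + 2 * (suc k * (suc k * (suc k * 1))) + 18 * (suc k * (suc k * 1)) + 76 * suc k + 105
  shift-index = solve-∀
  double : ∀ t → 108 * (2 * t) ≡ 2 * (108 * t)
  double = solve-∀

mainTheorem14 : (k : ℕ) → 1 ≤ k →
    ∃[ c ] (SubpathNumber (Ladder k) c
            × 3 * c + k ^ 3 + 12 * k ^ 2 + 56 * k + 99 ≡ 108 * 2 ^ k)
mainTheorem14 k _ =
  -- Adj (Ladder k) is defined by `with`, so its vertex arguments cannot be inferred.
  let c , pn≡c , paths≡ = subpathNumber-from-paths (Ladder k) (λ {u v} → ladder-sym k {u} {v}) (ladder-paths k)
  in c , pn≡c , pn-closed-form k c paths≡
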